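{- Let $G=G_1\cup G_2$ be a stochastic graph with distinguished node set $K=K_1\cup K_2$, where $G_1,G_2$ are stochastic subgraphs (edge parameters inherited from $G$) with no common edges, with distinguished sets $K_1\subseteq V(G_1)$, $K_2\subseteq V(G_2)$, and $K_1\cap K_2=V(G_1)\cap V(G_2)=\{k_1,\dots,k_n\}$. Assume every node $v\in K$ is joined by a path in $G$ to some $k_i$. Let $\mathcal{A}_1,\dots,\mathcal{A}_m$ be an enumeration of all partitions of $\{k_1,\dots,k_n\}$, $A$ the corresponding connectivity matrix and $(b_{ij})=A^{ -1}$. Then for every integer $l\ge 0$, in the ring $\mathbb{R}[x]/\langle x^{l+1}\rangle$, $$[\mathcal{I}_{K}(G)]_{l+1}=\sum_{i,j=1}^{m}b_{ij}\ [\mathcal{I}_{K_1^{\mathcal{A}_i}}(G_{1}^{\mathcal{A}_{i}})]_{l+1} \ [\mathcal{I}_{K_2^{\mathcal{A}_j}}(G_{2}^{\mathcal{A}_{j}})]_{l+1},$$ and the right-hand side does not depend on the chosen enumeration.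
   Context: Graphs $(V,E)$ are finite with edges $(\{a,b\},n)$, $a,b\in V$ (loops allowed), $n\in\mathbb{N}$, distinct edges having distinct labels. A stochastic graph assigns to each edge $e$ an independent Bernoulli variable with parameter $p_e\in[0,1]$. A state is $\mathcal{E}:E\to\{0,1\}$ with probability $P(\mathcal{E})=\prod_e p_e^{\mathcal{E}(e)}(1-p_e)^{1-\mathcal{E}(e)}$ and $\#\mathcal{E}=\#\mathcal{E}^{ -1}(1)$. For a distinguished set $K$, $\mathcal{E}$ is a $K$-PathSet if $K$ lies in the node set of one connected component of $(V,\mathcal{E}^{ -1}(1))$. Define $\mathcal{I}_K(G)=\sum_{i\ge0}a_ix^i\in\mathbb{R}[x]$ with $a_i=\sum P(\mathcal{E})$ over $K$-PathSets $\mathcal{E}$ with $\#\mathcal{E}=i$; $[f]_{l+1}$ denotes the class of $f\in\mathbb{R}[x]$ in $\mathbb{R}[x]/\langle x^{l+1}\rangle$ (the paper's constrained $l$-energy $K$-reliability of $G$ is $[\mathcal{I}_K(G)]_{l+1}$). Connectivity matrix: $A=(a_{ij})_{i,j=1}^m$ with $a_{ij}=1$ if the equivalence relation on $\{k_1,\dots,k_n\}$ generated by the partitions $\mathcal{A}_i$ and $\mathcal{A}_j$ has a single class, and $a_{ij}=0$ otherwise. It is a known fact that $A$ is invertible. For a partition $\mathcal{A}$ of $\{k_1,\dots,k_n\}$ and $l'\in\{1,2\}$, $G_{l'}^{\mathcal{A}}$ is obtained from $G_{l'}=(V,E)$ by identifying nodes in the same block of $\mathcal{A}$: with $\sim$ the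 equivalence relation on $V$ generated by $\mathcal{A}$ and $\pi:V\to V/\!\sim$ the quotient map, $G_{l'}^{\mathcal{A}}=(V/\!\sim,\{(\{\pi(a),\pi(b)\},n):(\{a,b\},n)\in E\})$ with inherited edge parameters and distinguished set $K_{l'}^{\mathcal{A}}=\pi(K_{l'})$. -}

module Defs where

open import Data.Bool using (Bool; true; false; _∧_; _∨_; not; if_then_else_)
open import Data.Nat using (ℕ; zero; suc; _∸_)
import Data.Nat as ℕ
open import Data.Fin using (Fin; zero; suc; splitAt; _≟_)
open import Data.Sum using (inj₁; inj₂)
open import Data.Product using (_×_; _,_; proj₁; proj₂; ∃)
open import Data.Maybe using (Maybe; just; nothing)
import Data.Maybe as Maybe
open import Relation.Nullary.Decidable using (⌊_⌋)
open import Relation.Binary.PropositionalEquality using (_≡_)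
open import Function.Bundles using (_⇔_)
open import Algebra.Bundles using (CommutativeRing)

anyFin : ∀ {n} → (Fin n → Bool) → Bool
anyFin {zero}  f = false
anyFin {suc n} f = f zero ∨ anyFin (λ i → f (suc i))

allFin : ∀ {n} → (Fin n → Bool) → Bool
allFin {zero}  f = true
allFin {suc n} f = f zero ∧ allFin (λ i → f (suc i))

findFin : ∀ {n} → (Fin n → Bool) → Maybe (Fin n)
findFin {zero}  f = nothing
findFin {suc n} f = if f zero then just zero else Maybe.map suc (findFin (λ i → f (suc i)))

_==_ : ∀ {n} → Fin n → Fin n → Bool
i == j = ⌊ i ≟ j ⌋

count : ∀ {n} → (Fin n → Bool) → ℕ
count {zero}  f = 0
count {suc n} f = (if f zero then 1 else 0) ℕ.+ count (λ i → f (suc i))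

-- Connectivity in a finite (undirected) graph given by a boolean
-- adjacency relation on Fin N: u and v are connected iff there is a walk
-- of length ≤ N from u to v (walks of length ≤ N suffice on N nodes).

reachWithin : ∀ {N} → (Fin N → Fin N → Bool) → ℕ → Fin N → Fin N → Bool
reachWithin adj zero    u v = u == v
reachWithin adj (suc s) u v =
  reachWithin adj s u v ∨ anyFin (λ w → reachWithin adj s u w ∧ adj w v)

connectedB : ∀ {N} → (Fin N → Fin N → Bool) → Fin N → Fin N → Bool
connectedB {N} adj = reachWithin adj N

-- Partitions of {k_1,…,k_n} ≅ Fin n, represented by a block labelling
-- Fin n → Fin n (the partition is its kernel: a, b same block iff same label).
-- Every partition of Fin n arises this way.

SamePartition : ∀ {n} → (Fin n → Fin n) → (Fin n → Fin n) → Set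
SamePartition P Q = ∀ a b → (P a ≡ P b) ⇔ (Q a ≡ Q b)

IsEnumeration : ∀ {m n} → (Fin m → (Fin n → Fin n)) → Set
IsEnumeration {m} {n} As =
  ∀ (P : Fin n → Fin n) →
    (∃ λ i → SamePartition (As i) P) ×
    (∀ i j → SamePartition (As i) P → SamePartition (As j) P → i ≡ j)

-- the equivalence relation generated by partitions P and Q has a single class
-- (exactly one class: the ground set is nonempty and everything is related)
singleClass : ∀ {n} → (Fin n → Fin n) → (Fin n → Fin n) → Bool
singleClass {n} P Q =
  anyFin {n} (λ _ → true) ∧
  allFin (λ a → allFin (λ b →
    connectedB (λ x y → (P x == P y) ∨ (Q x == Q y)) a b))

-- Everything involving probabilities, over a commutative ring R
-- (the paper's coefficient ring is ℝ).

module WithRing {c ℓ} (R : CommutativeRing c ℓ) where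
  open CommutativeRing R using (Carrier; _≈_; _+_; _*_; _-_; 0#; 1#)

  -- stochastic graph on node set Fin nv: edges are labelled by Fin ne,
  -- edge e has endpoints ends e (loops allowed) and parameter prob e
  record SGraph (nv : ℕ) : Set c where
    field
      ne   : ℕ
      ends : Fin ne → Fin nv × Fin nv
      prob : Fin ne → Carrier
  open SGraph public

  sumFin : ∀ {n} → (Fin n → Carrier) → Carrier
  sumFin {zero}  f = 0#
  sumFin {suc n} f = f zero + sumFin (λ i → f (suc i))

  prodFin : ∀ {n} → (Fin n → Carrier) → Carrier
  prodFin {zero}  f = 1#
  prodFin {suc n} f = f zero * prodFin (λ i → f (suc i))

  consB : ∀ {n} → Bool → (Fin n → Bool) → Fin (suc n) → Bool
  consB b s zero    = b
  consB b s (suc i) = s i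

  sumStates : (n : ℕ) → ((Fin n → Bool) → Carrier) → Carrier
  sumStates zero    f = f (λ ())
  sumStates (suc n) f = sumStates n (λ s → f (consB false s)) + sumStates n (λ s → f (consB true s))

  stateProb : ∀ {nv} (G : SGraph nv) → (Fin (ne G) → Bool) → Carrier
  stateProb G E = prodFin (λ e → if E e then prob G e else (1# - prob G e))

  joins : ∀ {nv} → Fin nv × Fin nv → Fin nv → Fin nv → Bool
  joins (a , b) u v = ((a == u) ∧ (b == v)) ∨ ((a == v) ∧ (b == u))

  stateAdj : ∀ {nv} (G : SGraph nv) → (Fin (ne G) → Bool) → Fin nv → Fin nv → Bool
  stateAdj G E u v = anyFin (λ e → E e ∧ joins (ends G e) u v)

  isPathSet : ∀ {nv} (G : SGraph nv) → (Fin nv → Bool) → (Fin (ne G) → Bool) → Bool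
  isPathSet G K E =
    allFin (λ u → allFin (λ v → not (K u ∧ K v) ∨ connectedB (stateAdj G E) u v))

  relCoeff : ∀ {nv} (G : SGraph nv) → (Fin nv → Bool) → ℕ → Carrier
  relCoeff G K i =
    sumStates (ne G) (λ E →
      if ⌊ count E ℕ.≟ i ⌋ ∧ isPathSet G K E then stateProb G E else 0#)

  _∪G_ : ∀ {nv} → SGraph nv → SGraph nv → SGraph nv
  G₁ ∪G G₂ = record
    { ne   = ne G₁ ℕ.+ ne G₂
    ; ends = λ e → caseE (splitAt (ne G₁) e)
    ; prob = λ e → caseP (splitAt (ne G₁) e)
    }
    where
      caseE : _ → _
      caseE (inj₁ e) = ends G₁ e
      caseE (inj₂ e) = ends G₂ e
      caseP : _ → _
      caseP (inj₁ e) = prob G₁ e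
      caseP (inj₂ e) = prob G₂ e

  -- quotient by the relation generated by a partition P of {k_1..k_n}
  -- (k : Fin n → Fin nv injective): each class is represented by a chosen
  -- node, rep u; V/∼ is identified with the set of representatives
  rep : ∀ {nv n} → (Fin n → Fin nv) → (Fin n → Fin n) → Fin nv → Fin nv
  rep k P u with findFin (λ a → k a == u)
  ... | nothing = u
  ... | just a with findFin (λ b → P b == P a)
  ...   | nothing = u
  ...   | just b  = k b

  quotG : ∀ {nv n} → SGraph nv → (Fin n → Fin nv) → (Fin n → Fin n) → SGraph nv
  quotG G k P = record
    { ne   = ne G
    ; ends = λ e → rep k P (proj₁ (ends G e)) , rep k P (proj₂ (ends G e))
    ; prob = prob G
    }

  quotK : ∀ {nv n} → (Fin nv → Bool) → (Fin n → Fin nv) → (Fin n → Fin n) → Fin nv → Bool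
  quotK K k P v = anyFin (λ u → K u ∧ (rep k P u == v))

  connMatrix : ∀ {m n} → (Fin m → (Fin n → Fin n)) → Fin m → Fin m → Carrier
  connMatrix As i j = if singleClass (As i) (As j) then 1# else 0#

  δ : ∀ {m} → Fin m → Fin m → Carrier
  δ i j = if i == j then 1# else 0#

  IsInverseOf : ∀ {m} → (Fin m → Fin m → Carrier) → (Fin m → Fin m → Carrier) → Set ℓ
  IsInverseOf B A =
    (∀ i j → sumFin (λ t → A i t * B t j) ≈ δ i j) ×
    (∀ i j → sumFin (λ t → B i t * A t j) ≈ δ i j)

  sumUpTo : ℕ → (ℕ → Carrier) → Carrier
  sumUpTo zero    h = h 0
  sumUpTo (suc k) h = sumUpTo k h + h (suc k)

  convCoeff : (ℕ → Carrier) → (ℕ → Carrier) → ℕ → Carrier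
  convCoeff f g k = sumUpTo k (λ a → f a * g (k ∸ a))

-- Write the coefficient of I_K(G) as a sum over states E = E₁ ⊕ E₂ of G₁ ∪ G₂.  Fix E₁, E₂, let cᵢ say
-- that every node of Kᵢ reaches the interface {k₁,…,kₙ} in Eᵢ, and let Lᵢ be the partition of the
-- interface into Eᵢ-components.  A walk can change sides only at the interface, so E is a K-path set
-- iff c₁ ∧ c₂ ∧ A(L₁,L₂) = 1, while Eᵢ is a path set of the quotient Gᵢ^𝒜 iff cᵢ ∧ A(Lᵢ,𝒜) = 1.
-- From Σ_{a,b} A(L₁,𝒜_a) b_{ab} A(𝒜_b,L₂) = A(L₁,L₂) the indicator of the union is Σ b_{ab} times the
-- product of the two quotient indicators.  Probabilities multiply over the disjoint edge sets and edge
-- counts add, so grading by the number of edges turns this pointwise identity into the convolution.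

module Submission where

open import Defs
open import Level using (_⊔_)
open import Data.Bool using (Bool; true; false; _∧_; _∨_; if_then_else_)
open import Data.Bool.Properties using (∨-assoc)
open import Data.Nat using (ℕ; zero; suc; _≤_; z≤n; _∸_) renaming (_+_ to _+ℕ_)
import Data.Nat as ℕ
import Data.Nat.Properties as ℕₚ
open import Data.Fin using (Fin; zero; suc; splitAt; _≟_)
import Data.Fin.Properties as Finₚ
open import Data.Product using (_×_; _,_; proj₁; proj₂; ∃)
open import Data.Sum using (_⊎_; inj₁; inj₂; [_,_]′)
import Data.Sum as Sum
open import Relation.Nullary using (yes; no; ¬_; contradiction)
open import Relation.Nullary.Decidable using (⌊_⌋)
open import Relation.Binary.PropositionalEquality as ≡ using (_≡_)
open import Function.Definitions using (Injective)
open import Function.Bundles using (_⇔_; mk⇔; Equivalence)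
open import Algebra.Bundles using (CommutativeRing)
open import Function.Base using (_∘_)

module FiniteSearch where
  open import Data.Nat using (s≤s)
  open import Data.Nat.Properties using (≤-trans; m≤n+m; m≤n⇒m≤1+n)
  open import Data.Maybe using (just; nothing)
  open import Relation.Nullary.Decidable using (Dec; isYes≗does; does-⇔)
  open import Relation.Binary.PropositionalEquality

  ∨-true-elim : ∀ {a b} → (a ∨ b) ≡ true → (a ≡ true) ⊎ (b ≡ true)
  ∨-true-elim {true}  _ = inj₁ refl
  ∨-true-elim {false} p = inj₂ p

  ∨-trueˡ : ∀ {a} b → a ≡ true → (a ∨ b) ≡ true
  ∨-trueˡ b refl = refl

  ∨-trueʳ : ∀ a {b} → b ≡ true → (a ∨ b) ≡ true
  ∨-trueʳ true  _ = refl
  ∨-trueʳ false p = p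

  ∧-true-elim : ∀ {a b} → (a ∧ b) ≡ true → (a ≡ true) × (b ≡ true)
  ∧-true-elim {true} p = refl , p

  ∧-true-intro : ∀ {a b} → a ≡ true → b ≡ true → (a ∧ b) ≡ true
  ∧-true-intro refl p = p

  true≢false : ∀ {b} → b ≡ true → ¬ (b ≡ false)
  true≢false refl ()

  bool-ext : ∀ {a b} → (a ≡ true → b ≡ true) → (b ≡ true → a ≡ true) → a ≡ b
  bool-ext {true}  {true}  f g = refl
  bool-ext {true}  {false} f g = sym (f refl)
  bool-ext {false} {true}  f g = g refl
  bool-ext {false} {false} f g = refl

  ⌊⌋-⇔ : ∀ {a b} {A : Set a} {B : Set b} → A ⇔ B → (a? : Dec A) (b? : Dec B) → ⌊ a? ⌋ ≡ ⌊ b? ⌋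
  ⌊⌋-⇔ A⇔B a? b? = trans (isYes≗does a?) (trans (does-⇔ A⇔B a? b?) (sym (isYes≗does b?)))

  ==⇒≡ : ∀ {n} {i j : Fin n} → (i == j) ≡ true → i ≡ j
  ==⇒≡ {i = i} {j} p with i ≟ j
  ... | yes i≡j = i≡j

  ==-refl : ∀ {n} (i : Fin n) → (i == i) ≡ true
  ==-refl i with i ≟ i
  ... | yes _ = refl
  ... | no i≢i = contradiction refl i≢i

  ≡⇒== : ∀ {n} {i j : Fin n} → i ≡ j → (i == j) ≡ true
  ≡⇒== {i = i} refl = ==-refl i

  anyFin⇒∃ : ∀ {n} (f : Fin n → Bool) → anyFin f ≡ true → ∃ λ i → f i ≡ true
  anyFin⇒∃ {suc n} f p with ∨-true-elim {f zero} p
  ... | inj₁ q = zero , q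
  ... | inj₂ q with anyFin⇒∃ (λ i → f (suc i)) q
  ...   | i , r = suc i , r

  ∃⇒anyFin : ∀ {n} (f : Fin n → Bool) i → f i ≡ true → anyFin f ≡ true
  ∃⇒anyFin {suc n} f zero    p = ∨-trueˡ _ p
  ∃⇒anyFin {suc n} f (suc i) p = ∨-trueʳ (f zero) (∃⇒anyFin (λ i → f (suc i)) i p)

  allFin⇒∀ : ∀ {n} (f : Fin n → Bool) → allFin f ≡ true → ∀ i → f i ≡ true
  allFin⇒∀ {suc n} f p zero    = proj₁ (∧-true-elim p)
  allFin⇒∀ {suc n} f p (suc i) = allFin⇒∀ (λ i → f (suc i)) (proj₂ (∧-true-elim p)) i

  ∀⇒allFin : ∀ {n} (f : Fin n → Bool) → (∀ i → f i ≡ true) → allFin f ≡ true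
  ∀⇒allFin {zero}  f p = refl
  ∀⇒allFin {suc n} f p = ∧-true-intro (p zero) (∀⇒allFin (λ i → f (suc i)) (λ i → p (suc i)))

  anyFin-cong : ∀ {n} {f g : Fin n → Bool} → (∀ i → f i ≡ g i) → anyFin f ≡ anyFin g
  anyFin-cong {zero}  e = refl
  anyFin-cong {suc n} e = cong₂ _∨_ (e zero) (anyFin-cong (λ i → e (suc i)))

  allFin-cong : ∀ {n} {f g : Fin n → Bool} → (∀ i → f i ≡ g i) → allFin f ≡ allFin g
  allFin-cong {zero}  e = refl
  allFin-cong {suc n} e = cong₂ _∧_ (e zero) (allFin-cong (λ i → e (suc i)))

  findFin-cong : ∀ {n} {f g : Fin n → Bool} → (∀ i → f i ≡ g i) → findFin f ≡ findFin g
  findFin-cong {zero} e = refl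
  findFin-cong {suc n} {f} {g} e
    rewrite e zero | findFin-cong {f = λ i → f (suc i)} {g = λ i → g (suc i)} (λ i → e (suc i)) = refl

  findFin-just⇒ : ∀ {n} (f : Fin n → Bool) {b} → findFin f ≡ just b → f b ≡ true
  findFin-just⇒ {suc n} f p with f zero in f0
  findFin-just⇒ {suc n} f refl | true = f0
  ... | false with findFin (λ i → f (suc i)) in found
  findFin-just⇒ {suc n} f refl | false | just c = findFin-just⇒ (λ i → f (suc i)) found

  findFin-succeeds : ∀ {n} (f : Fin n → Bool) i → f i ≡ true → ∃ λ b → findFin f ≡ just b
  findFin-succeeds {suc n} f i p with f zero in f0
  ... | true = zero , refl
  findFin-succeeds {suc n} f zero    p | false = contradiction f0 (true≢false p)
  findFin-succeeds {suc n} f (suc i) p | false with findFin-succeeds (λ i → f (suc i)) i p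
  ... | b , found rewrite found = suc b , refl

  findFin-nothing⇒ : ∀ {n} (f : Fin n → Bool) → findFin f ≡ nothing → ∀ i → ¬ (f i ≡ true)
  findFin-nothing⇒ f none i fi with findFin-succeeds f i fi
  ... | b , found with trans (sym none) found
  ... | ()

  ⊆-or-witness : ∀ {n} (X Y : Fin n → Bool) →
    (∀ v → X v ≡ true → Y v ≡ true) ⊎ (∃ λ w → X w ≡ true × Y w ≡ false)
  ⊆-or-witness {zero} X Y = inj₁ λ ()
  ⊆-or-witness {suc n} X Y with ⊆-or-witness (λ i → X (suc i)) (λ i → Y (suc i))
  ... | inj₂ (w , Xw , Yw) = inj₂ (suc w , Xw , Yw)
  ... | inj₁ X⊆Y with X zero in X0 | Y zero in Y0
  ...   | true  | false = inj₂ (zero , X0 , Y0)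
  ...   | true  | true  = inj₁ λ { zero _ → Y0 ; (suc v) → X⊆Y v }
  ...   | false | _     = inj₁ λ { zero p → contradiction X0 (true≢false p) ; (suc v) → X⊆Y v }

  count-mono : ∀ {n} (X Y : Fin n → Bool) → (∀ v → X v ≡ true → Y v ≡ true) → count X ≤ count Y
  count-mono {zero} X Y X⊆Y = z≤n
  count-mono {suc n} X Y X⊆Y with X zero in X0 | Y zero in Y0
  ... | true  | true  = s≤s (count-mono _ _ (λ v → X⊆Y (suc v)))
  ... | false | true  = m≤n⇒m≤1+n (count-mono _ _ (λ v → X⊆Y (suc v)))
  ... | false | false = count-mono _ _ (λ v → X⊆Y (suc v))
  ... | true  | false = contradiction Y0 (true≢false (X⊆Y zero X0))

  count-mono-< : ∀ {n} (X Y : Fin n → Bool) → (∀ v → X v ≡ true → Y v ≡ true) →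
    ∀ w → X w ≡ false → Y w ≡ true → suc (count X) ≤ count Y
  count-mono-< {suc n} X Y X⊆Y zero Xw Yw rewrite Xw | Yw = s≤s (count-mono _ _ (λ v → X⊆Y (suc v)))
  count-mono-< {suc n} X Y X⊆Y (suc w) Xw Yw with X zero in X0 | Y zero in Y0
  ... | true  | true  = s≤s (count-mono-< _ _ (λ v → X⊆Y (suc v)) w Xw Yw)
  ... | false | true  = m≤n⇒m≤1+n (count-mono-< _ _ (λ v → X⊆Y (suc v)) w Xw Yw)
  ... | false | false = count-mono-< _ _ (λ v → X⊆Y (suc v)) w Xw Yw
  ... | true  | false = contradiction Y0 (true≢false (X⊆Y zero X0))

  count≤n : ∀ {n} (X : Fin n → Bool) → count X ≤ n
  count≤n {zero}  X = z≤n
  count≤n {suc n} X with X zero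
  ... | true  = s≤s (count≤n _)
  ... | false = m≤n⇒m≤1+n (count≤n _)

  count-pos : ∀ {n} (X : Fin n → Bool) w → X w ≡ true → 1 ≤ count X
  count-pos {suc n} X zero    Xw rewrite Xw = s≤s z≤n
  count-pos {suc n} X (suc w) Xw = ≤-trans (count-pos (λ i → X (suc i)) w Xw) (m≤n+m _ _)

open FiniteSearch

module Connectivity where
  open import Data.Bool using (not)
  open import Data.Bool.Properties using (∨-comm)
  open import Data.Nat using (s≤s)
  open import Data.Nat.Properties
    using (≤-refl; ≤-trans; ≤-total; m≤n⇒m≤1+n; m≤n⇒∃[o]m+o≡n; +-comm; +-suc; +-identityʳ; <-irrefl)
  open import Data.Maybe using (just; nothing; fromMaybe)
  open import Data.Maybe.Properties using (just-injective)
  open import Relation.Binary.PropositionalEquality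

  Adj : ℕ → Set
  Adj N = Fin N → Fin N → Bool

  SymAdj : ∀ {N} → Adj N → Set
  SymAdj adj = ∀ {u v} → adj u v ≡ true → adj v u ≡ true

  Reach : ∀ {N} → Adj N → Fin N → Fin N → Set
  Reach adj u v = ∃ λ s → reachWithin adj s u v ≡ true

  reachWithin-trans : ∀ {N} (adj : Adj N) s t {u w v} → reachWithin adj s u w ≡ true →
    reachWithin adj t w v ≡ true → reachWithin adj (t +ℕ s) u v ≡ true
  reachWithin-trans adj s zero p q rewrite ==⇒≡ q = p
  reachWithin-trans adj s (suc t) {u} {w} {v} p q with ∨-true-elim {reachWithin adj t w v} q
  ... | inj₁ r = ∨-trueˡ _ (reachWithin-trans adj s t p r)
  ... | inj₂ r with anyFin⇒∃ (λ x → reachWithin adj t w x ∧ adj x v) r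
  ...   | x , r′ = ∨-trueʳ _ (∃⇒anyFin _ x
            (∧-true-intro (reachWithin-trans adj s t p (proj₁ (∧-true-elim r′))) (proj₂ (∧-true-elim r′))))

  Reach-refl : ∀ {N} (adj : Adj N) u → Reach adj u u
  Reach-refl adj u = 0 , ==-refl u

  Reach-trans : ∀ {N} (adj : Adj N) {u w v} → Reach adj u w → Reach adj w v → Reach adj u v
  Reach-trans adj (s , p) (t , q) = t +ℕ s , reachWithin-trans adj s t p q

  Reach-edge : ∀ {N} (adj : Adj N) {u v} → adj u v ≡ true → Reach adj u v
  Reach-edge adj {u} {v} p = 1 , ∨-trueʳ _ (∃⇒anyFin _ u (∧-true-intro (==-refl u) p))

  Reach-ind : ∀ {N} (adj : Adj N) (Rel : Fin N → Fin N → Set) →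
    (∀ u → Rel u u) → (∀ {u w v} → Rel u w → Rel w v → Rel u v) →
    (∀ {u v} → adj u v ≡ true → Rel u v) → ∀ {u v} → Reach adj u v → Rel u v
  Reach-ind adj Rel rel-refl rel-trans rel-edge (s , p) = go s p
    where
    go : ∀ s {u v} → reachWithin adj s u v ≡ true → Rel u v
    go zero p rewrite ==⇒≡ p = rel-refl _
    go (suc s) {u} {v} p with ∨-true-elim {reachWithin adj s u v} p
    ... | inj₁ r = go s r
    ... | inj₂ r with anyFin⇒∃ (λ x → reachWithin adj s u x ∧ adj x v) r
    ...   | x , r′ = rel-trans (go s (proj₁ (∧-true-elim r′))) (rel-edge (proj₂ (∧-true-elim r′)))

  Reach-mono : ∀ {N} (adj adj′ : Adj N) → (∀ {u v} → adj u v ≡ true → Reach adj′ u v) →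
    ∀ {u v} → Reach adj u v → Reach adj′ u v
  Reach-mono adj adj′ = Reach-ind adj (Reach adj′) (Reach-refl adj′) (Reach-trans adj′)

  Reach-sym : ∀ {N} (adj : Adj N) → SymAdj adj → ∀ {u v} → Reach adj u v → Reach adj v u
  Reach-sym adj sym-adj = Reach-ind adj (λ u v → Reach adj v u) (Reach-refl adj)
    (λ p q → Reach-trans adj q p) (λ e → Reach-edge adj (sym-adj e))

  connectedB-cong : ∀ {N} {adj adj′ : Adj N} → (∀ u v → adj u v ≡ adj′ u v) → ∀ u v →
    connectedB adj u v ≡ connectedB adj′ u v
  connectedB-cong {N} {adj} {adj′} e = go N
    where
    go : ∀ s u v → reachWithin adj s u v ≡ reachWithin adj′ s u v
    go zero    u v = refl
    go (suc s) u v = cong₂ _∨_ (go s u v) (anyFin-cong (λ w → cong₂ _∧_ (go s u w) (e w v)))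

  module _ {N} (adj : Adj N) (u : Fin N) where
    private
      reached : ℕ → Fin N → Bool
      reached s = reachWithin adj s u

      Stable : ℕ → Set
      Stable s = ∀ v → reached (suc s) v ≡ reached s v

      reached-mono : ∀ {s t} → s ≤ t → ∀ {v} → reached s v ≡ true → reached t v ≡ true
      reached-mono {s} s≤t {v} p with m≤n⇒∃[o]m+o≡n s≤t
      ... | o , refl = go o
        where
        go : ∀ o → reached (s +ℕ o) v ≡ true
        go zero    rewrite +-identityʳ s = p
        go (suc o) rewrite +-suc s o = ∨-trueˡ _ (go o)

      stable-forever : ∀ s → Stable s → ∀ t v → reached (t +ℕ s) v ≡ reached s v
      stable-forever s st zero    v = refl
      stable-forever s st (suc t) v = trans (step-cong v) (st v)
        where
        step-cong : ∀ v → reached (suc (t +ℕ s)) v ≡ reached (suc s) v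
        step-cong v = cong₂ _∨_ (stable-forever s st t v)
          (anyFin-cong (λ w → cong (_∧ adj w v) (stable-forever s st t w)))

      -- Pigeonhole: until it stabilises the reached set gains a node per step, and it has at most N nodes.
      grows-or-stable : ∀ s → suc s ≤ count (reached s) ⊎ ∃ λ s′ → s′ ≤ s × Stable s′
      grows-or-stable zero = inj₁ (count-pos (reached zero) u (==-refl u))
      grows-or-stable (suc s) with grows-or-stable s
      ... | inj₂ (s′ , s′≤s , st) = inj₂ (s′ , m≤n⇒m≤1+n s′≤s , st)
      ... | inj₁ grown with ⊆-or-witness (reached (suc s)) (reached s)
      ...   | inj₁ ⊆ = inj₂ (s , m≤n⇒m≤1+n ≤-refl , λ v → bool-ext (⊆ v) (∨-trueˡ _))
      ...   | inj₂ (w , new , old) =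
              inj₁ (≤-trans (s≤s grown) (count-mono-< (reached s) (reached (suc s)) (λ v → ∨-trueˡ _) w old new))

      stable-by-N : ∃ λ s → s ≤ N × Stable s
      stable-by-N with grows-or-stable N
      ... | inj₂ st = st
      ... | inj₁ c = contradiction (≤-trans c (count≤n (reached N))) (<-irrefl refl)

    reachWithin⇒connectedB : ∀ s {v} → reachWithin adj s u v ≡ true → connectedB adj u v ≡ true
    reachWithin⇒connectedB s {v} p with stable-by-N
    ... | s′ , s′≤N , st with ≤-total s s′
    ...   | inj₁ s≤s′ = reached-mono s′≤N (reached-mono s≤s′ p)
    ...   | inj₂ s′≤s with m≤n⇒∃[o]m+o≡n s′≤s
    ...     | o , refl = reached-mono s′≤N
                  (trans (sym (stable-forever s′ st o v)) (subst (λ z → reached z v ≡ true) (+-comm s′ o) p))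

  Reach⇒connectedB : ∀ {N} (adj : Adj N) {u v} → Reach adj u v → connectedB adj u v ≡ true
  Reach⇒connectedB adj {u} (s , p) = reachWithin⇒connectedB adj u s p

  connectedB⇒Reach : ∀ {N} (adj : Adj N) {u v} → connectedB adj u v ≡ true → Reach adj u v
  connectedB⇒Reach {N} adj p = N , p

  -- isPathSet G K E unfolds to connectsAll (stateAdj G E) K.
  connectsAll : ∀ {N} → Adj N → (Fin N → Bool) → Bool
  connectsAll adj K = allFin (λ u → allFin (λ v → not (K u ∧ K v) ∨ connectedB adj u v))

  connectsAll⇒Reach : ∀ {N} (adj : Adj N) K → connectsAll adj K ≡ true →
    ∀ u v → K u ≡ true → K v ≡ true → Reach adj u v
  connectsAll⇒Reach adj K p u v Ku Kv with allFin⇒∀ _ (allFin⇒∀ _ p u) v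
  ... | q rewrite Ku | Kv = connectedB⇒Reach adj q

  Reach⇒connectsAll : ∀ {N} (adj : Adj N) K → (∀ u v → K u ≡ true → K v ≡ true → Reach adj u v) →
    connectsAll adj K ≡ true
  Reach⇒connectsAll adj K h = ∀⇒allFin _ λ u → ∀⇒allFin _ λ v → go u v
    where
    go : ∀ u v → (not (K u ∧ K v) ∨ connectedB adj u v) ≡ true
    go u v with K u in Ku | K v in Kv
    ... | false | _     = refl
    ... | true  | false = refl
    ... | true  | true  = Reach⇒connectedB adj (h u v Ku Kv)

  connectsAll-cong : ∀ {N} {adj adj′ : Adj N} → (∀ u v → adj u v ≡ adj′ u v) → ∀ K →
    connectsAll adj K ≡ connectsAll adj′ K
  connectsAll-cong e K =
    allFin-cong λ u → allFin-cong λ v → cong (not (K u ∧ K v) ∨_) (connectedB-cong e u v)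

  blockAdj : ∀ {n} → (Fin n → Fin n) → (Fin n → Fin n) → Adj n
  blockAdj P Q a b = (P a == P b) ∨ (Q a == Q b)

  blockAdj-sym : ∀ {n} (P Q : Fin n → Fin n) → SymAdj (blockAdj P Q)
  blockAdj-sym P Q {a} {b} p with ∨-true-elim {P a == P b} p
  ... | inj₁ q = ∨-trueˡ _ (≡⇒== (sym (==⇒≡ q)))
  ... | inj₂ q = ∨-trueʳ _ (≡⇒== (sym (==⇒≡ q)))

  sameBlockˡ⇒Reach : ∀ {n} (P Q : Fin n → Fin n) {a b} → P a ≡ P b → Reach (blockAdj P Q) a b
  sameBlockˡ⇒Reach P Q e = Reach-edge (blockAdj P Q) (∨-trueˡ _ (≡⇒== e))

  sameBlockʳ⇒Reach : ∀ {n} (P Q : Fin n → Fin n) {a b} → Q a ≡ Q b → Reach (blockAdj P Q) a b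
  sameBlockʳ⇒Reach P Q {a} e = Reach-edge (blockAdj P Q) (∨-trueʳ (P a == _) (≡⇒== e))

  singleClass⇒Reach : ∀ {n} (P Q : Fin n → Fin n) → singleClass P Q ≡ true → ∀ a b → Reach (blockAdj P Q) a b
  singleClass⇒Reach P Q p a b =
    connectedB⇒Reach (blockAdj P Q) (allFin⇒∀ _ (allFin⇒∀ _ (proj₂ (∧-true-elim p)) a) b)

  Reach⇒singleClass : ∀ {n} (P Q : Fin n → Fin n) → Fin n → (∀ a b → Reach (blockAdj P Q) a b) →
    singleClass P Q ≡ true
  Reach⇒singleClass P Q a₀ h = ∧-true-intro (∃⇒anyFin _ a₀ refl)
    (∀⇒allFin _ λ a → ∀⇒allFin _ λ b → Reach⇒connectedB (blockAdj P Q) (h a b))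

  singleClass-comm : ∀ {n} (P Q : Fin n → Fin n) → singleClass P Q ≡ singleClass Q P
  singleClass-comm {n} P Q = cong (anyFin {n} (λ _ → true) ∧_)
    (allFin-cong λ a → allFin-cong λ b → connectedB-cong (λ x y → ∨-comm (P x == P y) (Q x == Q y)) a b)

  singleClass-congˡ : ∀ {n} {P P′ : Fin n → Fin n} (Q : Fin n → Fin n) → SamePartition P P′ →
    singleClass P Q ≡ singleClass P′ Q
  singleClass-congˡ {n} {P} {P′} Q P≈P′ = cong (anyFin {n} (λ _ → true) ∧_)
    (allFin-cong λ a → allFin-cong λ b → connectedB-cong sameAdj a b)
    where
    sameAdj : ∀ x y → blockAdj P Q x y ≡ blockAdj P′ Q x y
    sameAdj x y = cong (_∨ (Q x == Q y)) (bool-ext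
      (λ p → ≡⇒== (Equivalence.to (P≈P′ x y) (==⇒≡ p)))
      (λ p → ≡⇒== (Equivalence.from (P≈P′ x y) (==⇒≡ p))))

  singleClass-congʳ : ∀ {n} (P : Fin n → Fin n) {Q Q′ : Fin n → Fin n} → SamePartition Q Q′ →
    singleClass P Q ≡ singleClass P Q′
  singleClass-congʳ P {Q} {Q′} Q≈Q′ =
    trans (singleClass-comm P Q) (trans (singleClass-congˡ P Q≈Q′) (singleClass-comm Q′ P))

  module Interface {nv n} (k : Fin n → Fin nv) where

    IsInterface : Fin nv → Set
    IsInterface u = ∃ λ a → k a ≡ u

    interface? : ∀ u → IsInterface u ⊎ (∀ a → ¬ (k a ≡ u))
    interface? u with findFin (λ a → k a == u) in found
    ... | just a  = inj₁ (a , ==⇒≡ (findFin-just⇒ _ found))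
    ... | nothing = inj₂ λ a e → findFin-nothing⇒ _ found a (≡⇒== e)

  -- label a is the least b with k b in the component of k a, so its kernel is the partition of the
  -- interface into adj-components.
  module Component {nv n} (k : Fin n → Fin nv) (adj : Adj nv) (sym-adj : SymAdj adj) where

    linkedTo : Fin n → Fin n → Bool
    linkedTo a b = connectedB adj (k b) (k a)

    label : Fin n → Fin n
    label a = fromMaybe a (findFin (linkedTo a))

    private
      label-spec : ∀ a → ∃ λ b → findFin (linkedTo a) ≡ just b × label a ≡ b
      label-spec a with findFin-succeeds (linkedTo a) a (Reach⇒connectedB adj (Reach-refl adj (k a)))
      ... | b , found = b , found , cong (fromMaybe a) found

    label-≡⇒Reach : ∀ {a b} → label a ≡ label b → Reach adj (k a) (k b)
    label-≡⇒Reach {a} {b} e with label-spec a | label-spec b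
    ... | c , found , refl | c′ , found′ , refl = Reach-trans adj (Reach-sym adj sym-adj c⇝a) c⇝b
      where
      c⇝a : Reach adj (k c) (k a)
      c⇝a = connectedB⇒Reach adj (findFin-just⇒ (linkedTo a) found)
      c⇝b : Reach adj (k c) (k b)
      c⇝b = subst (λ z → Reach adj (k z) (k b)) (sym e) (connectedB⇒Reach adj (findFin-just⇒ (linkedTo b) found′))

    Reach⇒label-≡ : ∀ {a b} → Reach adj (k a) (k b) → label a ≡ label b
    Reach⇒label-≡ {a} {b} a⇝b with label-spec a | label-spec b
    ... | c , found , refl | c′ , found′ , refl = just-injective (trans (sym found) (trans sameSearch found′))
      where
      sameSearch : findFin (linkedTo a) ≡ findFin (linkedTo b)
      sameSearch = findFin-cong λ x → bool-ext
        (λ p → Reach⇒connectedB adj (Reach-trans adj (connectedB⇒Reach adj p) a⇝b))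
        (λ p → Reach⇒connectedB adj (Reach-trans adj (connectedB⇒Reach adj p) (Reach-sym adj sym-adj a⇝b)))

    reachesInterface : (Fin nv → Bool) → Bool
    reachesInterface K = allFin (λ v → not (K v) ∨ anyFin (λ a → connectedB adj v (k a)))

    reachesInterface-sound : ∀ K → reachesInterface K ≡ true → ∀ v → K v ≡ true → ∃ λ a → Reach adj v (k a)
    reachesInterface-sound K p v Kv with allFin⇒∀ _ p v
    ... | q rewrite Kv with anyFin⇒∃ _ q
    ...   | a , r = a , connectedB⇒Reach adj r

    reachesInterface-complete : ∀ K → (∀ v → K v ≡ true → ∃ λ a → Reach adj v (k a)) →
      reachesInterface K ≡ true
    reachesInterface-complete K h = ∀⇒allFin _ go
      where
      go : ∀ v → (not (K v) ∨ anyFin (λ a → connectedB adj v (k a))) ≡ true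
      go v with K v in Kv
      ... | false = refl
      ... | true with h v Kv
      ...   | a , r = ∃⇒anyFin _ a (Reach⇒connectedB adj r)

  -- rep lives inside WithRing, so the modules using it carry the otherwise irrelevant ring R.
  module Representative {c ℓ} (R : CommutativeRing c ℓ) {nv n} (k : Fin n → Fin nv)
    (k-inj : Injective _≡_ _≡_ k) (P : Fin n → Fin n) where
    open WithRing R using (rep)

    rep-outside : ∀ u → (∀ a → ¬ (k a ≡ u)) → rep k P u ≡ u
    rep-outside u outside with findFin (λ a → k a == u) in found
    ... | nothing = refl
    ... | just a  = contradiction (==⇒≡ (findFin-just⇒ _ found)) (outside a)

    rep-interface : ∀ a → ∃ λ b → findFin (λ b → P b == P a) ≡ just b × rep k P (k a) ≡ k b
    rep-interface a with findFin (λ a′ → k a′ == k a) in found₁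
    ... | nothing = contradiction (==-refl (k a)) (findFin-nothing⇒ _ found₁ a)
    ... | just a′ with findFin (λ b → P b == P a′) in found₂
    ...   | nothing = contradiction (==-refl (P a′)) (findFin-nothing⇒ _ found₂ a′)
    ...   | just b  = b , trans (findFin-cong λ x → cong (λ z → P x == P z) (sym a′≡a)) found₂ , refl
      where
      a′≡a : a′ ≡ a
      a′≡a = k-inj (==⇒≡ (findFin-just⇒ _ found₁))

    rep-interface-sameBlock : ∀ a → ∃ λ b → rep k P (k a) ≡ k b × P b ≡ P a
    rep-interface-sameBlock a with rep-interface a
    ... | b , found , e = b , e , ==⇒≡ (findFin-just⇒ _ found)

    rep-interface-cong : ∀ {a a′} → P a ≡ P a′ → rep k P (k a) ≡ rep k P (k a′)
    rep-interface-cong {a} {a′} Pa≡Pa′ with rep-interface a | rep-interface a′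
    ... | b , found , e | b′ , found′ , e′ = trans e (trans (cong k b≡b′) (sym e′))
      where
      b≡b′ : b ≡ b′
      b≡b′ = just-injective (trans (sym found) (trans (findFin-cong λ x → cong (λ z → P x == z) Pa≡Pa′) found′))

  module Quotient {c ℓ} (R : CommutativeRing c ℓ) {nv n} (k : Fin n → Fin nv) (k-inj : Injective _≡_ _≡_ k)
    (adj : Adj nv) (sym-adj : SymAdj adj) (K : Fin nv → Bool) (K-interface : ∀ a → K (k a) ≡ true)
    (a₀ : Fin n) (P : Fin n → Fin n) (adjQ : Adj nv)
    (edgeQ-lift : ∀ {x y} → adjQ x y ≡ true →
      ∃ λ u → ∃ λ w → adj u w ≡ true × WithRing.rep R k P u ≡ x × WithRing.rep R k P w ≡ y)
    (edge-push : ∀ {u w} → adj u w ≡ true → adjQ (WithRing.rep R k P u) (WithRing.rep R k P w) ≡ true) where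

    open WithRing R using (rep; quotK)
    open Interface k
    open Representative R k k-inj P
    open Component k adj sym-adj

    private
      ρ : Fin nv → Fin nv
      ρ = rep k P

      SameBlock : Fin n → Fin n → Set
      SameBlock = Reach (blockAdj label P)

      block-trans : ∀ {a b c} → SameBlock a b → SameBlock b c → SameBlock a c
      block-trans = Reach-trans (blockAdj label P)

      block-sym : ∀ {a b} → SameBlock a b → SameBlock b a
      block-sym = Reach-sym (blockAdj label P) (blockAdj-sym label P)

      reach-sameLabel : ∀ {a b} → Reach adj (k a) (k b) → SameBlock a b
      reach-sameLabel r = sameBlockˡ⇒Reach label P (Reach⇒label-≡ r)

    quotK-rep : ∀ u → K u ≡ true → quotK K k P (ρ u) ≡ true
    quotK-rep u Ku = ∃⇒anyFin _ u (∧-true-intro Ku (==-refl (ρ u)))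

    quotK⇒rep : ∀ x → quotK K k P x ≡ true → ∃ λ u → K u ≡ true × ρ u ≡ x
    quotK⇒rep x p with anyFin⇒∃ _ p
    ... | u , q = u , proj₁ (∧-true-elim q) , ==⇒≡ (proj₂ (∧-true-elim q))

    Reach-rep : ∀ {u w} → Reach adj u w → Reach adjQ (ρ u) (ρ w)
    Reach-rep = Reach-ind adj (λ u w → Reach adjQ (ρ u) (ρ w)) (λ u → Reach-refl adjQ _) (Reach-trans adjQ)
      (λ e → Reach-edge adjQ (edge-push e))

    SameBlock⇒Reach-rep : ∀ {a b} → SameBlock a b → Reach adjQ (ρ (k a)) (ρ (k b))
    SameBlock⇒Reach-rep = Reach-ind (blockAdj label P) (λ a b → Reach adjQ (ρ (k a)) (ρ (k b)))
      (λ a → Reach-refl adjQ _) (Reach-trans adjQ) edge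
      where
      edge : ∀ {a b} → blockAdj label P a b ≡ true → Reach adjQ (ρ (k a)) (ρ (k b))
      edge {a} {b} e with ∨-true-elim {label a == label b} e
      ... | inj₁ q = Reach-rep (label-≡⇒Reach (==⇒≡ q))
      ... | inj₂ q rewrite rep-interface-cong (==⇒≡ q) = Reach-refl adjQ _

    -- A quotient walk from a node off the interface lifts to adj until it first meets the interface.
    connectsAll-quot⇒reachesInterface : connectsAll adjQ (quotK K k P) ≡ true → reachesInterface K ≡ true
    connectsAll-quot⇒reachesInterface ps = reachesInterface-complete K reaches
      where
      Lifts : Fin nv → Fin nv → Set
      Lifts x y = IsInterface x ⊎ Reach adj x y ⊎ (∃ λ a → Reach adj x (k a))

      lifts-edge : ∀ {x y} → adjQ x y ≡ true → Lifts x y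
      lifts-edge e with edgeQ-lift e
      ... | u , w , uw , refl , refl with interface? u
      ...   | inj₁ (c , refl) with rep-interface-sameBlock c
      ...     | b , ρkc≡kb , _ = inj₁ (b , sym ρkc≡kb)
      lifts-edge e | u , w , uw , refl , refl | inj₂ u-out with interface? w
      ...   | inj₁ (c , refl) rewrite rep-outside u u-out = inj₂ (inj₂ (c , Reach-edge adj uw))
      ...   | inj₂ w-out rewrite rep-outside u u-out | rep-outside w w-out = inj₂ (inj₁ (Reach-edge adj uw))

      lifts-trans : ∀ {x y z} → Lifts x y → Lifts y z → Lifts x z
      lifts-trans (inj₁ i) _ = inj₁ i
      lifts-trans (inj₂ (inj₂ done)) _ = inj₂ (inj₂ done)
      lifts-trans (inj₂ (inj₁ r)) (inj₁ (c , refl)) = inj₂ (inj₂ (c , r))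
      lifts-trans (inj₂ (inj₁ r)) (inj₂ (inj₁ r′)) = inj₂ (inj₁ (Reach-trans adj r r′))
      lifts-trans (inj₂ (inj₁ r)) (inj₂ (inj₂ (a , r′))) = inj₂ (inj₂ (a , Reach-trans adj r r′))

      reaches : ∀ v → K v ≡ true → ∃ λ a → Reach adj v (k a)
      reaches v Kv with interface? v
      ... | inj₁ (a , refl) = a , Reach-refl adj _
      ... | inj₂ v-out with Reach-ind adjQ Lifts (λ u → inj₂ (inj₁ (Reach-refl adj u))) lifts-trans lifts-edge
            (connectsAll⇒Reach adjQ (quotK K k P) ps v (ρ (k a₀))
              (subst (λ z → quotK K k P z ≡ true) (rep-outside v v-out) (quotK-rep v Kv)) (quotK-rep (k a₀) (K-interface a₀)))
      ...   | inj₁ (a , e) = contradiction e (v-out a)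
      ...   | inj₂ (inj₂ done) = done
      ...   | inj₂ (inj₁ r) with rep-interface-sameBlock a₀
      ...     | b , ρka₀≡kb , _ = b , subst (Reach adj v) ρka₀≡kb r

    private
      leave-rep : ∀ u a → Reach adj (ρ u) (k a) → ∃ λ c → Reach adj u (k c) × SameBlock a c
      leave-rep u a r with interface? u
      ... | inj₂ u-out = a , subst (λ z → Reach adj z (k a)) (rep-outside u u-out) r , Reach-refl _ a
      ... | inj₁ (d , refl) with rep-interface-sameBlock d
      ...   | d′ , e , Pd′≡Pd = d , Reach-refl adj _ ,
              block-trans (block-sym (reach-sameLabel (subst (λ z → Reach adj z (k a)) e r))) (sameBlockʳ⇒Reach label P Pd′≡Pd)

      enter-rep : ∀ w c → Reach adj w (k c) → ∃ λ b → Reach adj (ρ w) (k b) × SameBlock c b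
      enter-rep w c r with interface? w
      ... | inj₂ w-out = c , subst (λ z → Reach adj z (k c)) (sym (rep-outside w w-out)) r , Reach-refl _ c
      ... | inj₁ (d , refl) with rep-interface-sameBlock d
      ...   | d′ , e , Pd′≡Pd = d′ , subst (λ z → Reach adj z (k d′)) (sym e) (Reach-refl adj _) ,
              block-trans (block-sym (reach-sameLabel r)) (block-sym (sameBlockʳ⇒Reach label P Pd′≡Pd))

    -- Along a quotient walk, the interface node reached from the current node moves within one block.
    connectsAll-quot⇒singleClass : connectsAll adjQ (quotK K k P) ≡ true → singleClass label P ≡ true
    connectsAll-quot⇒singleClass ps = Reach⇒singleClass label P a₀ sameBlock
      where
      Tracks : Fin nv → Fin nv → Set
      Tracks x y = ∀ a → Reach adj x (k a) → ∃ λ b → Reach adj y (k b) × SameBlock a b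

      tracks-edge : ∀ {x y} → adjQ x y ≡ true → Tracks x y
      tracks-edge e a r with edgeQ-lift e
      ... | u , w , uw , refl , refl with leave-rep u a r
      ...   | c , u⇝c , a~c with enter-rep w c (Reach-trans adj (Reach-edge adj (sym-adj uw)) u⇝c)
      ...     | b , w⇝b , c~b = b , w⇝b , block-trans a~c c~b

      tracks-trans : ∀ {x y z} → Tracks x y → Tracks y z → Tracks x z
      tracks-trans f g a r with f a r
      ... | b , r′ , a~b with g b r′
      ...   | c , r″ , b~c = c , r″ , block-trans a~b b~c

      sameBlock : ∀ a b → SameBlock a b
      sameBlock a b with enter-rep (k a) a (Reach-refl adj _)
      ... | b₀ , r₀ , a~b₀ with Reach-ind adjQ Tracks (λ u a r → a , r , Reach-refl _ a) tracks-trans tracks-edge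
            (connectsAll⇒Reach adjQ (quotK K k P) ps (ρ (k a)) (ρ (k b)) (quotK-rep (k a) (K-interface a)) (quotK-rep (k b) (K-interface b)))
            b₀ r₀
      ...   | b₁ , r₁ , b₀~b₁ with leave-rep (k b) b₁ r₁
      ...     | c , b⇝c , b₁~c = block-trans a~b₀ (block-trans b₀~b₁ (block-trans b₁~c (block-sym (reach-sameLabel b⇝c))))

    reachesInterface∧singleClass⇒connectsAll-quot :
      reachesInterface K ≡ true → singleClass label P ≡ true → connectsAll adjQ (quotK K k P) ≡ true
    reachesInterface∧singleClass⇒connectsAll-quot reaches single = Reach⇒connectsAll adjQ (quotK K k P) connects
      where
      connects : ∀ x y → quotK K k P x ≡ true → quotK K k P y ≡ true → Reach adjQ x y
      connects x y Kx Ky with quotK⇒rep x Kx | quotK⇒rep y Ky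
      ... | u , Ku , refl | w , Kw , refl
          with reachesInterface-sound K reaches u Ku | reachesInterface-sound K reaches w Kw
      ...   | a , u⇝a | b , w⇝b = Reach-trans adjQ (Reach-rep u⇝a)
              (Reach-trans adjQ (SameBlock⇒Reach-rep (singleClass⇒Reach label P single a b))
                (Reach-rep (Reach-sym adj sym-adj w⇝b)))

    connectsAll-quot : connectsAll adjQ (quotK K k P) ≡ (reachesInterface K ∧ singleClass label P)
    connectsAll-quot = bool-ext
      (λ ps → ∧-true-intro (connectsAll-quot⇒reachesInterface ps) (connectsAll-quot⇒singleClass ps))
      (λ p → reachesInterface∧singleClass⇒connectsAll-quot (proj₁ (∧-true-elim {reachesInterface K} p)) (proj₂ (∧-true-elim {reachesInterface K} p)))

  -- A walk can pass from A-edges to B-edges only at a node of V_A ∩ V_B, that is, at the interface.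
  module Exit {nv n} (k : Fin n → Fin nv) (adj adjA adjB : Adj nv) (symA : SymAdj adjA)
    (split : ∀ {x y} → adj x y ≡ true → adjA x y ≡ true ⊎ adjB x y ≡ true)
    (VA VB : Fin nv → Bool)
    (edgeA-VA : ∀ {u w} → adjA u w ≡ true → VA u ≡ true)
    (edgeB-VB : ∀ {u w} → adjB u w ≡ true → VB u ≡ true)
    (VA∩VB⊆interface : ∀ v → VA v ≡ true → VB v ≡ true → ∃ λ a → k a ≡ v) where

    open Interface k

    private
      stays-in-VA : ∀ {u w} → Reach adjA u w → VA u ≡ true → VA w ≡ true
      stays-in-VA = Reach-ind adjA (λ u w → VA u ≡ true → VA w ≡ true) (λ u p → p) (λ f g p → g (f p))
        (λ e _ → edgeA-VA (symA e))

      Exits : Fin nv → Fin nv → Set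
      Exits u w = IsInterface u ⊎ VA u ≡ false ⊎ Reach adjA u w ⊎ (∃ λ a → Reach adjA u (k a))

      exits-edge : ∀ {x y} → adj x y ≡ true → Exits x y
      exits-edge {x} e with split e
      ... | inj₁ q = inj₂ (inj₂ (inj₁ (Reach-edge adjA q)))
      ... | inj₂ q with VA x in VAx
      ...   | false = inj₂ (inj₁ refl)
      ...   | true  = inj₁ (VA∩VB⊆interface x VAx (edgeB-VB q))

      exits-trans : ∀ {x y z} → Exits x y → Exits y z → Exits x z
      exits-trans (inj₁ i) _ = inj₁ i
      exits-trans (inj₂ (inj₁ out)) _ = inj₂ (inj₁ out)
      exits-trans (inj₂ (inj₂ (inj₂ done))) _ = inj₂ (inj₂ (inj₂ done))
      exits-trans (inj₂ (inj₂ (inj₁ r))) (inj₁ (c , refl)) = inj₂ (inj₂ (inj₂ (c , r)))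
      exits-trans {x} (inj₂ (inj₂ (inj₁ r))) (inj₂ (inj₁ out)) with VA x in VAx
      ... | false = inj₂ (inj₁ refl)
      ... | true  = contradiction out (true≢false (stays-in-VA r VAx))
      exits-trans (inj₂ (inj₂ (inj₁ r))) (inj₂ (inj₂ (inj₁ r′))) = inj₂ (inj₂ (inj₁ (Reach-trans adjA r r′)))
      exits-trans (inj₂ (inj₂ (inj₁ r))) (inj₂ (inj₂ (inj₂ (a , r′)))) = inj₂ (inj₂ (inj₂ (a , Reach-trans adjA r r′)))

    reachesInterfaceᴬ : ∀ v → VA v ≡ true → ∀ a → Reach adj v (k a) → ∃ λ b → Reach adjA v (k b)
    reachesInterfaceᴬ v VAv a r with interface? v
    ... | inj₁ (b , refl) = b , Reach-refl adjA _
    ... | inj₂ v-out with Reach-ind adj Exits (λ u → inj₂ (inj₂ (inj₁ (Reach-refl adjA u)))) exits-trans exits-edge r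
    ...   | inj₁ (b , e) = contradiction e (v-out b)
    ...   | inj₂ (inj₁ out) = contradiction out (true≢false VAv)
    ...   | inj₂ (inj₂ (inj₁ r′)) = a , r′
    ...   | inj₂ (inj₂ (inj₂ done)) = done

  module Union {nv n} (k : Fin n → Fin nv) (adj₁ adj₂ : Adj nv) (sym₁ : SymAdj adj₁) (sym₂ : SymAdj adj₂)
    (V₁ V₂ K₁ K₂ : Fin nv → Bool)
    (edge₁-V₁ : ∀ {u w} → adj₁ u w ≡ true → V₁ u ≡ true)
    (edge₂-V₂ : ∀ {u w} → adj₂ u w ≡ true → V₂ u ≡ true)
    (V₁∩V₂⊆interface : ∀ v → V₁ v ≡ true → V₂ v ≡ true → ∃ λ a → k a ≡ v)
    (interface⊆V₁ : ∀ a → V₁ (k a) ≡ true)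
    (K₁⊆V₁ : ∀ v → K₁ v ≡ true → V₁ v ≡ true) (K₂⊆V₂ : ∀ v → K₂ v ≡ true → V₂ v ≡ true)
    (interface⊆K₁ : ∀ a → K₁ (k a) ≡ true) (a₀ : Fin n) where

    adjU : Adj nv
    adjU u v = adj₁ u v ∨ adj₂ u v

    KU : Fin nv → Bool
    KU v = K₁ v ∨ K₂ v

    module C₁ = Component k adj₁ sym₁
    module C₂ = Component k adj₂ sym₂

    private
      symU : SymAdj adjU
      symU {u} {v} e with ∨-true-elim {adj₁ u v} e
      ... | inj₁ q = ∨-trueˡ _ (sym₁ q)
      ... | inj₂ q = ∨-trueʳ _ (sym₂ q)

      Reach₁⇒ReachU : ∀ {u v} → Reach adj₁ u v → Reach adjU u v
      Reach₁⇒ReachU = Reach-mono adj₁ adjU (λ e → Reach-edge adjU (∨-trueˡ _ e))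

      Reach₂⇒ReachU : ∀ {u v} → Reach adj₂ u v → Reach adjU u v
      Reach₂⇒ReachU = Reach-mono adj₂ adjU (λ {u} e → Reach-edge adjU (∨-trueʳ (adj₁ u _) e))

      module Exit₁ = Exit k adjU adj₁ adj₂ sym₁ (λ {x} e → ∨-true-elim {adj₁ x _} e)
        V₁ V₂ edge₁-V₁ edge₂-V₂ V₁∩V₂⊆interface
      module Exit₂ = Exit k adjU adj₂ adj₁ sym₂ (λ {x} e → Sum.swap (∨-true-elim {adj₁ x _} e))
        V₂ V₁ edge₂-V₂ edge₁-V₁ (λ v p q → V₁∩V₂⊆interface v q p)

      SameBlock : Fin n → Fin n → Set
      SameBlock = Reach (blockAdj C₁.label C₂.label)

      block-trans : ∀ {a b c} → SameBlock a b → SameBlock b c → SameBlock a c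
      block-trans = Reach-trans (blockAdj C₁.label C₂.label)

      block-sym : ∀ {a b} → SameBlock a b → SameBlock b a
      block-sym = Reach-sym (blockAdj C₁.label C₂.label) (blockAdj-sym C₁.label C₂.label)

      KU-interface : ∀ a → KU (k a) ≡ true
      KU-interface a = ∨-trueˡ _ (interface⊆K₁ a)

    connectsAll⇒reachesInterface₁ : connectsAll adjU KU ≡ true → C₁.reachesInterface K₁ ≡ true
    connectsAll⇒reachesInterface₁ ps = C₁.reachesInterface-complete K₁ λ v K₁v →
      Exit₁.reachesInterfaceᴬ v (K₁⊆V₁ v K₁v) a₀ (connectsAll⇒Reach adjU KU ps v (k a₀) (∨-trueˡ _ K₁v) (KU-interface a₀))

    connectsAll⇒reachesInterface₂ : connectsAll adjU KU ≡ true → C₂.reachesInterface K₂ ≡ true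
    connectsAll⇒reachesInterface₂ ps = C₂.reachesInterface-complete K₂ λ v K₂v →
      Exit₂.reachesInterfaceᴬ v (K₂⊆V₂ v K₂v) a₀ (connectsAll⇒Reach adjU KU ps v (k a₀) (∨-trueʳ (K₁ v) K₂v) (KU-interface a₀))

    private
      Anchored : Fin nv → Fin n → Set
      Anchored x a = (V₁ x ≡ true × Reach adj₁ x (k a)) ⊎ (V₂ x ≡ true × Reach adj₂ x (k a))

      Tracks : Fin nv → Fin nv → Set
      Tracks x y = ∀ a → Anchored x a → ∃ λ b → Anchored y b × SameBlock a b

      tracks-edge : ∀ {x y} → adjU x y ≡ true → Tracks x y
      tracks-edge {x} {y} e a t with ∨-true-elim {adj₁ x y} e
      tracks-edge e a (inj₁ (_ , r)) | inj₁ q =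
        a , inj₁ (edge₁-V₁ (sym₁ q) , Reach-trans adj₁ (Reach-edge adj₁ (sym₁ q)) r) , Reach-refl _ a
      tracks-edge {x} e a (inj₂ (V₂x , r)) | inj₁ q with V₁∩V₂⊆interface x (edge₁-V₁ q) V₂x
      ... | c , refl = c , inj₁ (edge₁-V₁ (sym₁ q) , Reach-edge adj₁ (sym₁ q)) ,
            block-sym (sameBlockʳ⇒Reach C₁.label C₂.label (C₂.Reach⇒label-≡ r))
      tracks-edge e a (inj₂ (_ , r)) | inj₂ q =
        a , inj₂ (edge₂-V₂ (sym₂ q) , Reach-trans adj₂ (Reach-edge adj₂ (sym₂ q)) r) , Reach-refl _ a
      tracks-edge {x} e a (inj₁ (V₁x , r)) | inj₂ q with V₁∩V₂⊆interface x V₁x (edge₂-V₂ q)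
      ... | c , refl = c , inj₂ (edge₂-V₂ (sym₂ q) , Reach-edge adj₂ (sym₂ q)) ,
            block-sym (sameBlockˡ⇒Reach C₁.label C₂.label (C₁.Reach⇒label-≡ r))

      tracks-trans : ∀ {x y z} → Tracks x y → Tracks y z → Tracks x z
      tracks-trans f g a t with f a t
      ... | b , t′ , a~b with g b t′
      ...   | c , t″ , b~c = c , t″ , block-trans a~b b~c

    connectsAll⇒singleClass : connectsAll adjU KU ≡ true → singleClass C₁.label C₂.label ≡ true
    connectsAll⇒singleClass ps = Reach⇒singleClass C₁.label C₂.label a₀ sameBlock
      where
      sameBlock : ∀ a b → SameBlock a b
      sameBlock a b with Reach-ind adjU Tracks (λ u a t → a , t , Reach-refl _ a) tracks-trans tracks-edge
        (connectsAll⇒Reach adjU KU ps (k a) (k b) (KU-interface a) (KU-interface b)) a (inj₁ (interface⊆V₁ a , Reach-refl adj₁ _))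
      ... | b′ , inj₁ (_ , r) , a~b′ = block-trans a~b′ (block-sym (sameBlockˡ⇒Reach C₁.label C₂.label (C₁.Reach⇒label-≡ r)))
      ... | b′ , inj₂ (_ , r) , a~b′ = block-trans a~b′ (block-sym (sameBlockʳ⇒Reach C₁.label C₂.label (C₂.Reach⇒label-≡ r)))

    private
      SameBlock⇒ReachU : ∀ {a b} → SameBlock a b → Reach adjU (k a) (k b)
      SameBlock⇒ReachU = Reach-ind (blockAdj C₁.label C₂.label) (λ a b → Reach adjU (k a) (k b))
        (λ a → Reach-refl adjU _) (Reach-trans adjU) edge
        where
        edge : ∀ {a b} → blockAdj C₁.label C₂.label a b ≡ true → Reach adjU (k a) (k b)
        edge {a} {b} e with ∨-true-elim {C₁.label a == C₁.label b} e
        ... | inj₁ q = Reach₁⇒ReachU (C₁.label-≡⇒Reach (==⇒≡ q))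
        ... | inj₂ q = Reach₂⇒ReachU (C₂.label-≡⇒Reach (==⇒≡ q))

    reachesInterface∧singleClass⇒connectsAll : C₁.reachesInterface K₁ ≡ true → C₂.reachesInterface K₂ ≡ true →
      singleClass C₁.label C₂.label ≡ true → connectsAll adjU KU ≡ true
    reachesInterface∧singleClass⇒connectsAll reaches₁ reaches₂ single = Reach⇒connectsAll adjU KU connects
      where
      toInterface : ∀ u → KU u ≡ true → ∃ λ a → Reach adjU u (k a)
      toInterface u p with ∨-true-elim {K₁ u} p
      ... | inj₁ q with C₁.reachesInterface-sound K₁ reaches₁ u q
      ...   | a , r = a , Reach₁⇒ReachU r
      toInterface u p | inj₂ q with C₂.reachesInterface-sound K₂ reaches₂ u q
      ...   | a , r = a , Reach₂⇒ReachU r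

      connects : ∀ x y → KU x ≡ true → KU y ≡ true → Reach adjU x y
      connects x y KUx KUy with toInterface x KUx | toInterface y KUy
      ... | a , x⇝a | b , y⇝b = Reach-trans adjU x⇝a (Reach-trans adjU
            (SameBlock⇒ReachU (singleClass⇒Reach C₁.label C₂.label single a b)) (Reach-sym adjU symU y⇝b))

    connectsAll-union : connectsAll adjU KU ≡ (C₁.reachesInterface K₁ ∧ (C₂.reachesInterface K₂ ∧ singleClass C₁.label C₂.label))
    connectsAll-union = bool-ext
      (λ ps → ∧-true-intro (connectsAll⇒reachesInterface₁ ps)
                (∧-true-intro (connectsAll⇒reachesInterface₂ ps) (connectsAll⇒singleClass ps)))
      (λ p → let r₁ , rest = ∧-true-elim {C₁.reachesInterface K₁} p
                 r₂ , single = ∧-true-elim {C₂.reachesInterface K₂} rest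
             in reachesInterface∧singleClass⇒connectsAll r₁ r₂ single)

open Connectivity

module Sums {c ℓ} (R : CommutativeRing c ℓ) where
  open CommutativeRing R hiding (zero)
  open WithRing R
  open import Algebra.Properties.CommutativeSemigroup +-commutativeSemigroup using ()
    renaming (interchange to +-interchange)
  open import Algebra.Properties.CommutativeSemigroup *-commutativeSemigroup using ()
    renaming (x∙yz≈y∙xz to *-leftComm)
  open import Relation.Binary.Reasoning.Setoid setoid

  record Linear {X : Set} (S : (X → Carrier) → Carrier) : Set (c ⊔ ℓ) where
    field
      lin-cong : ∀ {f g} → (∀ x → f x ≈ g x) → S f ≈ S g
      lin-+    : ∀ f g → S (λ x → f x + g x) ≈ S f + S g
      lin-0    : S (λ _ → 0#) ≈ 0#
      lin-*ˡ   : ∀ a f → S (λ x → a * f x) ≈ a * S f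

    lin-*ʳ : ∀ a f → S (λ x → f x * a) ≈ S f * a
    lin-*ʳ a f = begin
      S (λ x → f x * a) ≈⟨ lin-cong (λ x → *-comm (f x) a) ⟩
      S (λ x → a * f x) ≈⟨ lin-*ˡ a f ⟩
      a * S f           ≈⟨ *-comm a (S f) ⟩
      S f * a           ∎
  open Linear public

  sumFin-linear : ∀ n → Linear (sumFin {n})
  sumFin-linear n = record { lin-cong = cong′ n ; lin-+ = +′ n ; lin-0 = 0′ n ; lin-*ˡ = *′ n }
    where
    cong′ : ∀ n {f g} → (∀ x → f x ≈ g x) → sumFin {n} f ≈ sumFin g
    cong′ zero    e = refl
    cong′ (suc n) e = +-cong (e zero) (cong′ n (λ x → e (suc x)))
    +′ : ∀ n f g → sumFin {n} (λ x → f x + g x) ≈ sumFin f + sumFin g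
    +′ zero    f g = sym (+-identityˡ 0#)
    +′ (suc n) f g = trans (+-congˡ (+′ n _ _)) (+-interchange _ _ _ _)
    0′ : ∀ n → sumFin {n} (λ _ → 0#) ≈ 0#
    0′ zero    = refl
    0′ (suc n) = trans (+-identityˡ _) (0′ n)
    *′ : ∀ n a f → sumFin {n} (λ x → a * f x) ≈ a * sumFin f
    *′ zero    a f = sym (zeroʳ a)
    *′ (suc n) a f = trans (+-congˡ (*′ n a _)) (sym (distribˡ a _ _))

  sumFin² : ∀ {m} → (Fin m → Fin m → Carrier) → Carrier
  sumFin² f = sumFin (λ a → sumFin (λ b → f a b))

  sumStates-linear : ∀ n → Linear (sumStates n)
  sumStates-linear n = record { lin-cong = cong′ n ; lin-+ = +′ n ; lin-0 = 0′ n ; lin-*ˡ = *′ n }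
    where
    cong′ : ∀ n {f g} → (∀ x → f x ≈ g x) → sumStates n f ≈ sumStates n g
    cong′ zero    e = e _
    cong′ (suc n) e = +-cong (cong′ n (λ x → e _)) (cong′ n (λ x → e _))
    +′ : ∀ n f g → sumStates n (λ x → f x + g x) ≈ sumStates n f + sumStates n g
    +′ zero    f g = refl
    +′ (suc n) f g = trans (+-cong (+′ n _ _) (+′ n _ _)) (+-interchange _ _ _ _)
    0′ : ∀ n → sumStates n (λ _ → 0#) ≈ 0#
    0′ zero    = refl
    0′ (suc n) = trans (+-cong (0′ n) (0′ n)) (+-identityˡ _)
    *′ : ∀ n a f → sumStates n (λ x → a * f x) ≈ a * sumStates n f
    *′ zero    a f = refl
    *′ (suc n) a f = trans (+-cong (*′ n a _) (*′ n a _)) (sym (distribˡ a _ _))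

  sumUpTo-linear : ∀ k → Linear (sumUpTo k)
  sumUpTo-linear k = record { lin-cong = cong′ k ; lin-+ = +′ k ; lin-0 = 0′ k ; lin-*ˡ = *′ k }
    where
    cong′ : ∀ k {f g} → (∀ x → f x ≈ g x) → sumUpTo k f ≈ sumUpTo k g
    cong′ zero    e = e 0
    cong′ (suc k) e = +-cong (cong′ k e) (e _)
    +′ : ∀ k f g → sumUpTo k (λ x → f x + g x) ≈ sumUpTo k f + sumUpTo k g
    +′ zero    f g = refl
    +′ (suc k) f g = trans (+-congʳ (+′ k _ _)) (+-interchange _ _ _ _)
    0′ : ∀ k → sumUpTo k (λ _ → 0#) ≈ 0#
    0′ zero    = refl
    0′ (suc k) = trans (+-identityʳ _) (0′ k)
    *′ : ∀ k a f → sumUpTo k (λ x → a * f x) ≈ a * sumUpTo k f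
    *′ zero    a f = refl
    *′ (suc k) a f = trans (+-congʳ (*′ k a _)) (sym (distribˡ a _ _))

  nested-linear : ∀ {X Y : Set} {S : (X → Carrier) → Carrier} {T : (Y → Carrier) → Carrier} →
    Linear S → Linear T → Linear (λ (h : X × Y → Carrier) → S (λ x → T (λ y → h (x , y))))
  nested-linear LS LT = record
    { lin-cong = λ e → lin-cong LS (λ x → lin-cong LT (λ y → e (x , y)))
    ; lin-+    = λ f g → trans (lin-cong LS (λ x → lin-+ LT _ _)) (lin-+ LS _ _)
    ; lin-0    = trans (lin-cong LS (λ x → lin-0 LT)) (lin-0 LS)
    ; lin-*ˡ   = λ a f → trans (lin-cong LS (λ x → lin-*ˡ LT a _)) (lin-*ˡ LS a _)
    }

  linear-bilinear : ∀ {X Y : Set} {S : (X → Carrier) → Carrier} {T : (Y → Carrier) → Carrier} →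
    Linear S → Linear T → ∀ f g → S (λ x → T (λ y → f x * g y)) ≈ S f * T g
  linear-bilinear {T = T} LS LT f g =
    trans (lin-cong LS (λ x → lin-*ˡ LT (f x) g)) (lin-*ʳ LS (T g) f)

  linear-sumFin : ∀ {X : Set} {S : (X → Carrier) → Carrier} → Linear S → ∀ n (f : X → Fin n → Carrier) →
    S (λ x → sumFin (f x)) ≈ sumFin (λ a → S (λ x → f x a))
  linear-sumFin L zero    f = lin-0 L
  linear-sumFin L (suc n) f = trans (lin-+ L _ _) (+-congˡ (linear-sumFin L n (λ x a → f x (suc a))))

  linear-sumUpTo : ∀ {X : Set} {S : (X → Carrier) → Carrier} → Linear S → ∀ k (f : X → ℕ → Carrier) →
    S (λ x → sumUpTo k (f x)) ≈ sumUpTo k (λ a → S (λ x → f x a))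
  linear-sumUpTo L zero    f = lin-cong L (λ _ → refl)
  linear-sumUpTo L (suc k) f = trans (lin-+ L _ _) (+-congʳ (linear-sumUpTo L k f))

  ι : Bool → Carrier
  ι b = if b then 1# else 0#

  if-then-0≈ι* : ∀ b x → (if b then x else 0#) ≈ ι b * x
  if-then-0≈ι* true  x = sym (*-identityˡ x)
  if-then-0≈ι* false x = sym (zeroˡ x)

  ι-∧ : ∀ a b → ι (a ∧ b) ≈ ι a * ι b
  ι-∧ true  b = sym (*-identityˡ _)
  ι-∧ false b = sym (zeroˡ _)

  sumFin-δ : ∀ {m} (f : Fin m → Carrier) j → sumFin (λ a → f a * δ a j) ≈ f j
  sumFin-δ {suc m} f zero = begin
    f zero * 1# + sumFin (λ a → f (suc a) * 0#) ≈⟨ +-cong (*-identityʳ _) (lin-cong (sumFin-linear m) (λ a → zeroʳ _)) ⟩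
    f zero + sumFin {m} (λ _ → 0#)            ≈⟨ +-congˡ (lin-0 (sumFin-linear m)) ⟩
    f zero + 0#                                ≈⟨ +-identityʳ _ ⟩
    f zero                                     ∎
  sumFin-δ {suc m} f (suc j) = begin
    f zero * 0# + sumFin (λ a → f (suc a) * δ (suc a) (suc j))
      ≈⟨ +-cong (zeroʳ _) (lin-cong (sumFin-linear m) (λ a → *-congˡ (reflexive (≡.cong ι (suc-== a j))))) ⟩
    0# + sumFin (λ a → f (suc a) * δ a j) ≈⟨ +-identityˡ _ ⟩
    sumFin (λ a → f (suc a) * δ a j)      ≈⟨ sumFin-δ (λ a → f (suc a)) j ⟩
    f (suc j)                             ∎
    where
    suc-== : ∀ {k} (a j : Fin k) → (suc a == suc j) ≡ (a == j)
    suc-== a j = ⌊⌋-⇔ (mk⇔ Finₚ.suc-injective (≡.cong suc)) (suc a ≟ suc j) (a ≟ j)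

  inverse-sandwich : ∀ {m} (A B : Fin m → Fin m → Carrier) →
    (∀ a j → sumFin (λ t → B a t * A t j) ≈ δ a j) →
    ∀ i j → sumFin² (λ a b → B a b * (A i a * A b j)) ≈ A i j
  inverse-sandwich {m} A B B*A≈I i j = begin
    sumFin² (λ a b → B a b * (A i a * A b j))
      ≈⟨ lin-cong (sumFin-linear m) (λ a → trans (lin-cong (sumFin-linear m) (λ b → *-leftComm _ _ _)) (lin-*ˡ (sumFin-linear m) _ _)) ⟩
    sumFin (λ a → A i a * sumFin (λ b → B a b * A b j))
      ≈⟨ lin-cong (sumFin-linear m) (λ a → *-congˡ (B*A≈I a j)) ⟩
    sumFin (λ a → A i a * δ a j)
      ≈⟨ sumFin-δ (A i) j ⟩
    A i j ∎

  invertible-zero⇒trivial : ∀ {m} (A B : Fin m → Fin m → Carrier) → IsInverseOf B A →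
    (∀ i j → A i j ≈ 0#) → Fin m → ∀ x y → x ≈ y
  invertible-zero⇒trivial {m} A B (A*B≈I , _) A≈0 i₀ x y = trans (≈0 x) (sym (≈0 y))
    where
    1≈0 : 1# ≈ 0#
    1≈0 = begin
      1#                                   ≡⟨ ≡.cong ι (≡.sym (==-refl i₀)) ⟩
      δ i₀ i₀                              ≈⟨ sym (A*B≈I i₀ i₀) ⟩
      sumFin (λ t → A i₀ t * B t i₀)       ≈⟨ lin-cong (sumFin-linear m) (λ t → trans (*-congʳ (A≈0 i₀ t)) (zeroˡ _)) ⟩
      sumFin {m} (λ _ → 0#)                ≈⟨ lin-0 (sumFin-linear m) ⟩
      0#                                   ∎
    ≈0 : ∀ x → x ≈ 0#
    ≈0 x = trans (sym (*-identityʳ x)) (trans (*-congˡ 1≈0) (zeroʳ x))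

  δℕ : ℕ → ℕ → Carrier
  δℕ x t = ι ⌊ x ℕ.≟ t ⌋

  private
    δℕ-refl : ∀ x → δℕ x x ≈ 1#
    δℕ-refl x with x ℕ.≟ x
    ... | yes _   = refl
    ... | no x≢x = contradiction ≡.refl x≢x

    δℕ-≢ : ∀ {x t} → ¬ (x ≡ t) → δℕ x t ≈ 0#
    δℕ-≢ {x} {t} x≢t with x ℕ.≟ t
    ... | yes x≡t = contradiction x≡t x≢t
    ... | no _    = refl

  sumUpTo-δℕ-≤ : ∀ i x (g : ℕ → Carrier) → x ≤ i → sumUpTo i (λ t → δℕ x t * g t) ≈ g x
  sumUpTo-δℕ-> : ∀ i x (g : ℕ → Carrier) → ¬ (x ≤ i) → sumUpTo i (λ t → δℕ x t * g t) ≈ 0#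
  sumUpTo-δℕ-≤ zero zero g x≤i = trans (*-congʳ (δℕ-refl 0)) (*-identityˡ _)
  sumUpTo-δℕ-≤ (suc i) x g x≤i with x ℕ.≟ suc i
  ... | yes ≡.refl = trans (+-cong (sumUpTo-δℕ-> i (suc i) g (ℕₚ.<-irrefl ≡.refl)) refl)
                           (trans (+-identityˡ _) (*-identityˡ _))
  ... | no x≢i = trans (+-cong (sumUpTo-δℕ-≤ i x g (ℕₚ.≤-pred (ℕₚ.≤∧≢⇒< x≤i x≢i))) (zeroˡ _))
                       (+-identityʳ _)
  sumUpTo-δℕ-> zero x g x≰i = trans (*-congʳ (δℕ-≢ λ { ≡.refl → x≰i z≤n })) (zeroˡ _)
  sumUpTo-δℕ-> (suc i) x g x≰i =
    trans (+-cong (sumUpTo-δℕ-> i x g (λ x≤i → x≰i (ℕₚ.m≤n⇒m≤1+n x≤i)))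
                  (trans (*-congʳ (δℕ-≢ λ { ≡.refl → x≰i ℕₚ.≤-refl })) (zeroˡ _)))
          (+-identityˡ _)

  δℕ-+ : ∀ x y i → δℕ (x +ℕ y) i ≈ sumUpTo i (λ t → δℕ x t * δℕ y (i ∸ t))
  δℕ-+ x y i with x ℕ.≤? i
  ... | yes x≤i = sym (trans (sumUpTo-δℕ-≤ i x (λ t → δℕ y (i ∸ t)) x≤i)
                             (reflexive (≡.cong ι (⌊⌋-⇔ shift (y ℕ.≟ i ∸ x) (x +ℕ y ℕ.≟ i)))))
    where
    shift : (y ≡ i ∸ x) ⇔ (x +ℕ y ≡ i)
    shift = mk⇔ (λ e → ≡.trans (≡.cong (x +ℕ_) e) (ℕₚ.m+[n∸m]≡n x≤i))
                (λ e → ≡.trans (≡.sym (ℕₚ.m+n∸m≡n x y)) (≡.cong (_∸ x) e))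
  ... | no x≰i = trans (δℕ-≢ λ e → x≰i (≡.subst (x ≤_) e (ℕₚ.m≤m+n x y)))
                       (sym (sumUpTo-δℕ-> i x (λ t → δℕ y (i ∸ t)) x≰i))

module States {c ℓ} (R : CommutativeRing c ℓ) where
  open CommutativeRing R hiding (zero)
  open WithRing R
  open Sums R
  open import Algebra.Properties.CommutativeSemigroup *-commutativeSemigroup using ()
    renaming (x∙yz≈y∙xz to *-leftComm; interchange to *-interchange)
  open import Relation.Binary.Reasoning.Setoid setoid

  infixr 5 _⊕_
  _⊕_ : ∀ {n₁ n₂} → (Fin n₁ → Bool) → (Fin n₂ → Bool) → Fin (n₁ +ℕ n₂) → Bool
  _⊕_ {zero}   E₁ E₂ = E₂
  _⊕_ {suc n₁} E₁ E₂ = consB (E₁ zero) ((λ i → E₁ (suc i)) ⊕ E₂)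

  count-⊕ : ∀ {n₁ n₂} (E₁ : Fin n₁ → Bool) (E₂ : Fin n₂ → Bool) → count (E₁ ⊕ E₂) ≡ count E₁ +ℕ count E₂
  count-⊕ {zero}   E₁ E₂ = ≡.refl
  count-⊕ {suc n₁} E₁ E₂ = ≡.trans (≡.cong ((if E₁ zero then 1 else 0) +ℕ_) (count-⊕ (λ i → E₁ (suc i)) E₂))
    (≡.sym (ℕₚ.+-assoc (if E₁ zero then 1 else 0) _ _))

  private
    [,]-splitAt-suc : ∀ {a} {A : Set a} {n₁ n₂} (x₁ : Fin (suc n₁) → A) (x₂ : Fin n₂ → A) (s : Fin n₁ ⊎ Fin n₂) →
      [ x₁ , x₂ ]′ (Sum.map₁ suc s) ≡ [ (λ i → x₁ (suc i)) , x₂ ]′ s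
    [,]-splitAt-suc x₁ x₂ (inj₁ _) = ≡.refl
    [,]-splitAt-suc x₁ x₂ (inj₂ _) = ≡.refl

  anyFin-⊕ : ∀ {A : Set} n₁ {n₂} (F : Bool → A → Bool) (E₁ : Fin n₁ → Bool) (E₂ : Fin n₂ → Bool)
    (x₁ : Fin n₁ → A) (x₂ : Fin n₂ → A) →
    anyFin (λ e → F ((E₁ ⊕ E₂) e) ([ x₁ , x₂ ]′ (splitAt n₁ e)))
      ≡ (anyFin (λ e → F (E₁ e) (x₁ e)) ∨ anyFin (λ e → F (E₂ e) (x₂ e)))
  anyFin-⊕ zero F E₁ E₂ x₁ x₂ = ≡.refl
  anyFin-⊕ (suc n₁) F E₁ E₂ x₁ x₂ = ≡.trans (≡.cong (F (E₁ zero) (x₁ zero) ∨_)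
    (≡.trans (anyFin-cong (λ e → ≡.cong (F _) ([,]-splitAt-suc x₁ x₂ (splitAt n₁ e))))
      (anyFin-⊕ n₁ F (λ i → E₁ (suc i)) E₂ (λ i → x₁ (suc i)) x₂)))
    (≡.sym (∨-assoc (F (E₁ zero) (x₁ zero)) _ _))

  prodFin-cong : ∀ {n} {f g : Fin n → Carrier} → (∀ x → f x ≈ g x) → prodFin f ≈ prodFin g
  prodFin-cong {zero}  e = refl
  prodFin-cong {suc n} e = *-cong (e zero) (prodFin-cong (λ x → e (suc x)))

  prodFin-⊕ : ∀ {a} {A : Set a} n₁ {n₂} (F : Bool → A → Carrier) (E₁ : Fin n₁ → Bool) (E₂ : Fin n₂ → Bool)
    (x₁ : Fin n₁ → A) (x₂ : Fin n₂ → A) →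
    prodFin (λ e → F ((E₁ ⊕ E₂) e) ([ x₁ , x₂ ]′ (splitAt n₁ e)))
      ≈ prodFin (λ e → F (E₁ e) (x₁ e)) * prodFin (λ e → F (E₂ e) (x₂ e))
  prodFin-⊕ zero F E₁ E₂ x₁ x₂ = sym (*-identityˡ _)
  prodFin-⊕ (suc n₁) F E₁ E₂ x₁ x₂ = begin
    F (E₁ zero) (x₁ zero) * prodFin (λ e → F (((λ i → E₁ (suc i)) ⊕ E₂) e) ([ x₁ , x₂ ]′ (Sum.map₁ suc (splitAt n₁ e))))
      ≈⟨ *-congˡ (prodFin-cong (λ e → reflexive (≡.cong (F _) ([,]-splitAt-suc x₁ x₂ (splitAt n₁ e))))) ⟩
    F (E₁ zero) (x₁ zero) * prodFin (λ e → F (((λ i → E₁ (suc i)) ⊕ E₂) e) ([ (λ i → x₁ (suc i)) , x₂ ]′ (splitAt n₁ e)))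
      ≈⟨ *-congˡ (prodFin-⊕ n₁ F (λ i → E₁ (suc i)) E₂ (λ i → x₁ (suc i)) x₂) ⟩
    F (E₁ zero) (x₁ zero) * (prodFin (λ e → F (E₁ (suc e)) (x₁ (suc e))) * prodFin (λ e → F (E₂ e) (x₂ e)))
      ≈⟨ sym (*-assoc _ _ _) ⟩
    prodFin (λ e → F (E₁ e) (x₁ e)) * prodFin (λ e → F (E₂ e) (x₂ e)) ∎

  sumStates-⊕ : ∀ n₁ n₂ (f : (Fin (n₁ +ℕ n₂) → Bool) → Carrier) →
    sumStates (n₁ +ℕ n₂) f ≈ sumStates n₁ (λ E₁ → sumStates n₂ (λ E₂ → f (E₁ ⊕ E₂)))
  sumStates-⊕ zero     n₂ f = refl
  sumStates-⊕ (suc n₁) n₂ f = +-cong (sumStates-⊕ n₁ n₂ _) (sumStates-⊕ n₁ n₂ _)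

  graded : ∀ n → ((Fin n → Bool) → Carrier) → ℕ → Carrier
  graded n w i = sumStates n (λ E → δℕ (count E) i * w E)

  pathSetWeight : ∀ {nv} (G : SGraph nv) → (Fin nv → Bool) → (Fin (ne G) → Bool) → Carrier
  pathSetWeight G K E = ι (isPathSet G K E) * stateProb G E

  relCoeff≈graded : ∀ {nv} (G : SGraph nv) K i → relCoeff G K i ≈ graded (ne G) (pathSetWeight G K) i
  relCoeff≈graded G K i = lin-cong (sumStates-linear (ne G)) λ E →
    trans (if-then-0≈ι* _ _) (trans (*-congʳ (ι-∧ _ _)) (*-assoc _ _ _))

  convCoeff-cong : ∀ {f f′ g g′ : ℕ → Carrier} → (∀ t → f t ≈ f′ t) → (∀ t → g t ≈ g′ t) →
    ∀ i → convCoeff f g i ≈ convCoeff f′ g′ i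
  convCoeff-cong f≈f′ g≈g′ i = lin-cong (sumUpTo-linear i) (λ t → *-cong (f≈f′ t) (g≈g′ (i ∸ t)))

  graded-⊕ : ∀ {m} (B : Fin m → Fin m → Carrier) n₁ n₂
    (w₁ : Fin m → (Fin n₁ → Bool) → Carrier) (w₂ : Fin m → (Fin n₂ → Bool) → Carrier)
    (w : (Fin (n₁ +ℕ n₂) → Bool) → Carrier) →
    (∀ E₁ E₂ → w (E₁ ⊕ E₂) ≈ sumFin² (λ a b → B a b * (w₁ a E₁ * w₂ b E₂))) →
    ∀ i → graded (n₁ +ℕ n₂) w i
            ≈ sumFin² (λ a b → B a b * convCoeff (graded n₁ (w₁ a)) (graded n₂ (w₂ b)) i)
  graded-⊕ {m} B n₁ n₂ w₁ w₂ w factor i = begin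
    graded (n₁ +ℕ n₂) w i
      ≈⟨ sumStates-⊕ n₁ n₂ _ ⟩
    N (λ (E₁ , E₂) → δℕ (count (E₁ ⊕ E₂)) i * w (E₁ ⊕ E₂))
      ≈⟨ lin-cong LN (λ (E₁ , E₂) → pointwise E₁ E₂) ⟩
    N (λ (E₁ , E₂) → sumFin² λ a b → B a b * sumUpTo i (λ t → X a t E₁ * Y b (i ∸ t) E₂))
      ≈⟨ linear-sumFin LN m _ ⟩
    sumFin (λ a → N (λ (E₁ , E₂) → sumFin λ b → B a b * sumUpTo i (λ t → X a t E₁ * Y b (i ∸ t) E₂)))
      ≈⟨ lin-cong Lm (λ a → linear-sumFin LN m _) ⟩
    sumFin² (λ a b → N (λ (E₁ , E₂) → B a b * sumUpTo i (λ t → X a t E₁ * Y b (i ∸ t) E₂)))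
      ≈⟨ lin-cong Lm (λ a → lin-cong Lm (λ b → trans (lin-*ˡ LN _ _) (*-congˡ (linear-sumUpTo LN i _)))) ⟩
    sumFin² (λ a b → B a b * sumUpTo i (λ t → N (λ (E₁ , E₂) → X a t E₁ * Y b (i ∸ t) E₂)))
      ≈⟨ lin-cong Lm (λ a → lin-cong Lm (λ b → *-congˡ (lin-cong (sumUpTo-linear i) (λ t →
           linear-bilinear (sumStates-linear n₁) (sumStates-linear n₂) (X a t) (Y b (i ∸ t)))))) ⟩
    sumFin² (λ a b → B a b * convCoeff (graded n₁ (w₁ a)) (graded n₂ (w₂ b)) i) ∎
    where
    N : ((Fin n₁ → Bool) × (Fin n₂ → Bool) → Carrier) → Carrier
    N h = sumStates n₁ (λ E₁ → sumStates n₂ (λ E₂ → h (E₁ , E₂)))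

    Lm : Linear (sumFin {m})
    Lm = sumFin-linear m
    LN : Linear N
    LN = nested-linear (sumStates-linear n₁) (sumStates-linear n₂)

    X : Fin m → ℕ → (Fin n₁ → Bool) → Carrier
    X a t E₁ = δℕ (count E₁) t * w₁ a E₁

    Y : Fin m → ℕ → (Fin n₂ → Bool) → Carrier
    Y b t E₂ = δℕ (count E₂) t * w₂ b E₂

    pointwise : ∀ E₁ E₂ → δℕ (count (E₁ ⊕ E₂)) i * w (E₁ ⊕ E₂)
                           ≈ sumFin² λ a b → B a b * sumUpTo i (λ t → X a t E₁ * Y b (i ∸ t) E₂)
    pointwise E₁ E₂ = begin
      δℕ (count (E₁ ⊕ E₂)) i * w (E₁ ⊕ E₂)
        ≈⟨ *-cong (trans (reflexive (≡.cong (λ z → δℕ z i) (count-⊕ E₁ E₂))) (δℕ-+ (count E₁) (count E₂) i)) (factor E₁ E₂) ⟩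
      U * sumFin² (λ a b → B a b * W a b)
        ≈⟨ sym (trans (lin-cong Lm (λ a → lin-*ˡ Lm U _)) (lin-*ˡ Lm U _)) ⟩
      sumFin² (λ a b → U * (B a b * W a b))
        ≈⟨ lin-cong Lm (λ a → lin-cong Lm (λ b → *-leftComm U (B a b) (W a b))) ⟩
      sumFin² (λ a b → B a b * (U * W a b))
        ≈⟨ lin-cong Lm (λ a → lin-cong Lm (λ b → *-congˡ (sym (lin-*ʳ (sumUpTo-linear i) (W a b) u)))) ⟩
      sumFin² (λ a b → B a b * sumUpTo i (λ t → u t * W a b))
        ≈⟨ lin-cong Lm (λ a → lin-cong Lm (λ b → *-congˡ (lin-cong (sumUpTo-linear i) (λ t → *-interchange _ _ _ _)))) ⟩
      sumFin² (λ a b → B a b * sumUpTo i (λ t → X a t E₁ * Y b (i ∸ t) E₂)) ∎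
      where
      u : ℕ → Carrier
      u t = δℕ (count E₁) t * δℕ (count E₂) (i ∸ t)
      U : Carrier
      U = sumUpTo i u
      W : Fin m → Fin m → Carrier
      W a b = w₁ a E₁ * w₂ b E₂

  private
    joins⇒ : ∀ {nv} (p : Fin nv × Fin nv) u v → joins p u v ≡ true →
      (proj₁ p ≡ u × proj₂ p ≡ v) ⊎ (proj₁ p ≡ v × proj₂ p ≡ u)
    joins⇒ (a , b) u v q with ∨-true-elim {(a == u) ∧ (b == v)} q
    ... | inj₁ r = inj₁ (==⇒≡ (proj₁ (∧-true-elim r)) , ==⇒≡ (proj₂ (∧-true-elim r)))
    ... | inj₂ r = inj₂ (==⇒≡ (proj₁ (∧-true-elim r)) , ==⇒≡ (proj₂ (∧-true-elim r)))

    joins-ends : ∀ {nv} (p : Fin nv × Fin nv) → joins p (proj₁ p) (proj₂ p) ≡ true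
    joins-ends (a , b) = ∨-trueˡ _ (∧-true-intro (==-refl a) (==-refl b))

    joins-ends-swapped : ∀ {nv} (p : Fin nv × Fin nv) → joins p (proj₂ p) (proj₁ p) ≡ true
    joins-ends-swapped (a , b) = ∨-trueʳ ((a == b) ∧ (b == a)) (∧-true-intro (==-refl a) (==-refl b))

    stateAdj-intro : ∀ {nv} (G : SGraph nv) E e {u v} → E e ≡ true → joins (ends G e) u v ≡ true →
      stateAdj G E u v ≡ true
    stateAdj-intro G E e Ee j = ∃⇒anyFin _ e (∧-true-intro Ee j)

  stateAdj-sym : ∀ {nv} (G : SGraph nv) E → SymAdj (stateAdj G E)
  stateAdj-sym G E {u} {v} q with anyFin⇒∃ _ q
  ... | e , r with joins⇒ (ends G e) u v (proj₂ (∧-true-elim r))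
  ...   | inj₁ (≡.refl , ≡.refl) = stateAdj-intro G E e (proj₁ (∧-true-elim r)) (joins-ends-swapped (ends G e))
  ...   | inj₂ (≡.refl , ≡.refl) = stateAdj-intro G E e (proj₁ (∧-true-elim r)) (joins-ends (ends G e))

  stateAdj⇒V : ∀ {nv} (G : SGraph nv) E (V : Fin nv → Bool) →
    (∀ e → (V (proj₁ (ends G e)) ∧ V (proj₂ (ends G e))) ≡ true) →
    ∀ {u w} → stateAdj G E u w ≡ true → V u ≡ true
  stateAdj⇒V G E V ends∈V {u} {w} q with anyFin⇒∃ _ q
  ... | e , r with joins⇒ (ends G e) u w (proj₂ (∧-true-elim r))
  ...   | inj₁ (≡.refl , _) = proj₁ (∧-true-elim (ends∈V e))
  ...   | inj₂ (_ , ≡.refl) = proj₂ (∧-true-elim {V (proj₁ (ends G e))} (ends∈V e))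

  stateAdj-∪ : ∀ {nv} (G₁ G₂ : SGraph nv) E₁ E₂ u v →
    stateAdj (G₁ ∪G G₂) (E₁ ⊕ E₂) u v ≡ (stateAdj G₁ E₁ u v ∨ stateAdj G₂ E₂ u v)
  stateAdj-∪ G₁ G₂ E₁ E₂ u v =
    ≡.trans (anyFin-cong (λ e → ≡.cong (λ z → (E₁ ⊕ E₂) e ∧ joins z u v) (ends-∪ e)))
            (anyFin-⊕ (ne G₁) (λ b x → b ∧ joins x u v) E₁ E₂ (ends G₁) (ends G₂))
    where
    ends-∪ : ∀ e → ends (G₁ ∪G G₂) e ≡ [ ends G₁ , ends G₂ ]′ (splitAt (ne G₁) e)
    ends-∪ e with splitAt (ne G₁) e
    ... | inj₁ _ = ≡.refl
    ... | inj₂ _ = ≡.refl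

  stateProb-∪ : ∀ {nv} (G₁ G₂ : SGraph nv) E₁ E₂ →
    stateProb (G₁ ∪G G₂) (E₁ ⊕ E₂) ≈ stateProb G₁ E₁ * stateProb G₂ E₂
  stateProb-∪ G₁ G₂ E₁ E₂ =
    trans (prodFin-cong (λ e → reflexive (≡.cong (λ z → if (E₁ ⊕ E₂) e then z else (1# - z)) (prob-∪ e))))
          (prodFin-⊕ (ne G₁) (λ b x → if b then x else (1# - x)) E₁ E₂ (prob G₁) (prob G₂))
    where
    prob-∪ : ∀ e → prob (G₁ ∪G G₂) e ≡ [ prob G₁ , prob G₂ ]′ (splitAt (ne G₁) e)
    prob-∪ e with splitAt (ne G₁) e
    ... | inj₁ _ = ≡.refl
    ... | inj₂ _ = ≡.refl

  stateAdj-quot⇒ : ∀ {nv n} (G : SGraph nv) (k : Fin n → Fin nv) P E {x y} →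
    stateAdj (quotG G k P) E x y ≡ true →
    ∃ λ u → ∃ λ w → stateAdj G E u w ≡ true × rep k P u ≡ x × rep k P w ≡ y
  stateAdj-quot⇒ G k P E {x} {y} q with anyFin⇒∃ _ q
  ... | e , r with joins⇒ (rep k P (proj₁ (ends G e)) , rep k P (proj₂ (ends G e))) x y (proj₂ (∧-true-elim r))
  ...   | inj₁ (e₁ , e₂) = proj₁ (ends G e) , proj₂ (ends G e) ,
            stateAdj-intro G E e (proj₁ (∧-true-elim r)) (joins-ends (ends G e)) , e₁ , e₂
  ...   | inj₂ (e₁ , e₂) = proj₂ (ends G e) , proj₁ (ends G e) ,
            stateAdj-intro G E e (proj₁ (∧-true-elim r)) (joins-ends-swapped (ends G e)) , e₂ , e₁

  stateAdj⇒quot : ∀ {nv n} (G : SGraph nv) (k : Fin n → Fin nv) P E {u w} → stateAdj G E u w ≡ true →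
    stateAdj (quotG G k P) E (rep k P u) (rep k P w) ≡ true
  stateAdj⇒quot G k P E {u} {w} q with anyFin⇒∃ _ q
  ... | e , r with joins⇒ (ends G e) u w (proj₂ (∧-true-elim r))
  ...   | inj₁ (≡.refl , ≡.refl) = stateAdj-intro (quotG G k P) E e (proj₁ (∧-true-elim r))
            (joins-ends (rep k P (proj₁ (ends G e)) , rep k P (proj₂ (ends G e))))
  ...   | inj₂ (≡.refl , ≡.refl) = stateAdj-intro (quotG G k P) E e (proj₁ (∧-true-elim r))
            (joins-ends-swapped (rep k P (proj₁ (ends G e)) , rep k P (proj₂ (ends G e))))

module Gluing {c ℓ} (R : CommutativeRing c ℓ) where
  open CommutativeRing R hiding (zero)
  open WithRing R
  open Sums R
  open States R
  open import Relation.Binary.Reasoning.Setoid setoid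
  open import Algebra.Properties.CommutativeSemigroup *-commutativeSemigroup using ()
    renaming (interchange to *-interchange; x∙yz≈y∙xz to *-leftComm)

  module Setting {nv n} (G₁ G₂ : SGraph nv) (V₁ V₂ K₁ K₂ : Fin nv → Bool)
    (k : Fin n → Fin nv) (k-inj : Injective _≡_ _≡_ k)
    (ends∈V₁ : ∀ e → (V₁ (proj₁ (ends G₁ e)) ∧ V₁ (proj₂ (ends G₁ e))) ≡ true)
    (ends∈V₂ : ∀ e → (V₂ (proj₁ (ends G₂ e)) ∧ V₂ (proj₂ (ends G₂ e))) ≡ true)
    (K₁⊆V₁ : ∀ v → K₁ v ≡ true → V₁ v ≡ true) (K₂⊆V₂ : ∀ v → K₂ v ≡ true → V₂ v ≡ true)
    (K₁∩K₂≡interface : ∀ v → ((K₁ v ∧ K₂ v) ≡ true) ⇔ (∃ λ a → k a ≡ v))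
    (V₁∩V₂≡interface : ∀ v → ((V₁ v ∧ V₂ v) ≡ true) ⇔ (∃ λ a → k a ≡ v))
    {m} (As : Fin m → (Fin n → Fin n)) (enum : IsEnumeration As)
    (B : Fin m → Fin m → Carrier) (B*A≈I : ∀ a j → sumFin (λ t → B a t * connMatrix As t j) ≈ δ a j)
    (a₀ : Fin n) where

    KU : Fin nv → Bool
    KU v = K₁ v ∨ K₂ v

    private
      interface⊆V : ∀ a → (V₁ (k a) ∧ V₂ (k a)) ≡ true
      interface⊆V a = Equivalence.from (V₁∩V₂≡interface (k a)) (a , ≡.refl)

      interface⊆K : ∀ a → (K₁ (k a) ∧ K₂ (k a)) ≡ true
      interface⊆K a = Equivalence.from (K₁∩K₂≡interface (k a)) (a , ≡.refl)

      indexOf : (Fin n → Fin n) → Fin m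
      indexOf P = proj₁ (proj₁ (enum P))

      indexOf-same : ∀ P → SamePartition (As (indexOf P)) P
      indexOf-same P = proj₂ (proj₁ (enum P))

    module _ (E₁ : Fin (ne G₁) → Bool) (E₂ : Fin (ne G₂) → Bool) where
      private
        adj₁ : Adj nv
        adj₁ = stateAdj G₁ E₁
        adj₂ : Adj nv
        adj₂ = stateAdj G₂ E₂
        sym₁ : SymAdj adj₁
        sym₁ = stateAdj-sym G₁ E₁
        sym₂ : SymAdj adj₂
        sym₂ = stateAdj-sym G₂ E₂

        module U = Union k adj₁ adj₂ sym₁ sym₂ V₁ V₂ K₁ K₂
          (stateAdj⇒V G₁ E₁ V₁ ends∈V₁) (stateAdj⇒V G₂ E₂ V₂ ends∈V₂)
          (λ v p q → Equivalence.to (V₁∩V₂≡interface v) (∧-true-intro p q))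
          (λ a → proj₁ (∧-true-elim (interface⊆V a))) K₁⊆V₁ K₂⊆V₂
          (λ a → proj₁ (∧-true-elim (interface⊆K a))) a₀

        module Q₁ (P : Fin n → Fin n) = Quotient R k k-inj adj₁ sym₁ K₁
          (λ a → proj₁ (∧-true-elim (interface⊆K a))) a₀ P (stateAdj (quotG G₁ k P) E₁)
          (stateAdj-quot⇒ G₁ k P E₁) (stateAdj⇒quot G₁ k P E₁)
        module Q₂ (P : Fin n → Fin n) = Quotient R k k-inj adj₂ sym₂ K₂
          (λ a → proj₂ (∧-true-elim {K₁ (k a)} (interface⊆K a))) a₀ P (stateAdj (quotG G₂ k P) E₂)
          (stateAdj-quot⇒ G₂ k P E₂) (stateAdj⇒quot G₂ k P E₂)

        L₁ L₂ : Fin n → Fin n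
        L₁ = U.C₁.label
        L₂ = U.C₂.label
        c₁ c₂ : Bool
        c₁ = U.C₁.reachesInterface K₁
        c₂ = U.C₂.reachesInterface K₂
        i₁ i₂ : Fin m
        i₁ = indexOf L₁
        i₂ = indexOf L₂

        A : Fin m → Fin m → Carrier
        A = connMatrix As

        Lm : Linear (sumFin {m})
        Lm = sumFin-linear m

        ι-pathSet₁ : ∀ a → ι c₁ * A i₁ a ≈ ι (isPathSet (quotG G₁ k (As a)) (quotK K₁ k (As a)) E₁)
        ι-pathSet₁ a = begin
          ι c₁ * ι (singleClass (As i₁) (As a)) ≡⟨ ≡.cong (λ s → ι c₁ * ι s) (singleClass-congˡ (As a) (indexOf-same L₁)) ⟩
          ι c₁ * ι (singleClass L₁ (As a))      ≈⟨ sym (ι-∧ c₁ _) ⟩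
          ι (c₁ ∧ singleClass L₁ (As a))        ≡⟨ ≡.cong ι (≡.sym (Q₁.connectsAll-quot (As a))) ⟩
          ι (isPathSet (quotG G₁ k (As a)) (quotK K₁ k (As a)) E₁) ∎

        ι-pathSet₂ : ∀ b → ι c₂ * A b i₂ ≈ ι (isPathSet (quotG G₂ k (As b)) (quotK K₂ k (As b)) E₂)
        ι-pathSet₂ b = begin
          ι c₂ * ι (singleClass (As b) (As i₂)) ≡⟨ ≡.cong (λ s → ι c₂ * ι s)
                                                     (≡.trans (singleClass-congʳ (As b) (indexOf-same L₂)) (singleClass-comm (As b) L₂)) ⟩
          ι c₂ * ι (singleClass L₂ (As b))      ≈⟨ sym (ι-∧ c₂ _) ⟩
          ι (c₂ ∧ singleClass L₂ (As b))        ≡⟨ ≡.cong ι (≡.sym (Q₂.connectsAll-quot (As b))) ⟩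
          ι (isPathSet (quotG G₂ k (As b)) (quotK K₂ k (As b)) E₂) ∎

      ι-pathSet-∪ : ι (isPathSet (G₁ ∪G G₂) KU (E₁ ⊕ E₂))
        ≈ sumFin² (λ a b → B a b * (ι (isPathSet (quotG G₁ k (As a)) (quotK K₁ k (As a)) E₁)
                              * ι (isPathSet (quotG G₂ k (As b)) (quotK K₂ k (As b)) E₂)))
      ι-pathSet-∪ = begin
        ι (isPathSet (G₁ ∪G G₂) KU (E₁ ⊕ E₂))
          ≡⟨ ≡.cong ι (≡.trans (connectsAll-cong (stateAdj-∪ G₁ G₂ E₁ E₂) KU) U.connectsAll-union) ⟩
        ι (c₁ ∧ (c₂ ∧ singleClass L₁ L₂))
          ≈⟨ trans (ι-∧ c₁ _) (trans (*-congˡ (ι-∧ c₂ _)) (sym (*-assoc _ _ _))) ⟩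
        (ι c₁ * ι c₂) * ι (singleClass L₁ L₂)
          ≡⟨ ≡.cong (λ s → (ι c₁ * ι c₂) * ι s) (≡.sym
               (≡.trans (singleClass-congˡ (As i₂) (indexOf-same L₁)) (singleClass-congʳ L₁ (indexOf-same L₂)))) ⟩
        (ι c₁ * ι c₂) * A i₁ i₂
          ≈⟨ *-congˡ (sym (inverse-sandwich A B B*A≈I i₁ i₂)) ⟩
        (ι c₁ * ι c₂) * sumFin² (λ a b → B a b * (A i₁ a * A b i₂))
          ≈⟨ sym (trans (lin-cong Lm (λ a → lin-*ˡ Lm _ _)) (lin-*ˡ Lm _ _)) ⟩
        sumFin² (λ a b → (ι c₁ * ι c₂) * (B a b * (A i₁ a * A b i₂)))
          ≈⟨ lin-cong Lm (λ a → lin-cong Lm (λ b →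
               trans (*-leftComm _ _ _) (*-congˡ (trans (*-interchange _ _ _ _) (*-cong (ι-pathSet₁ a) (ι-pathSet₂ b)))))) ⟩
        sumFin² (λ a b → B a b * (ι (isPathSet (quotG G₁ k (As a)) (quotK K₁ k (As a)) E₁)
                              * ι (isPathSet (quotG G₂ k (As b)) (quotK K₂ k (As b)) E₂))) ∎

      pathSetWeight-⊕ : pathSetWeight (G₁ ∪G G₂) KU (E₁ ⊕ E₂)
        ≈ sumFin² (λ a b → B a b * (pathSetWeight (quotG G₁ k (As a)) (quotK K₁ k (As a)) E₁
                                    * pathSetWeight (quotG G₂ k (As b)) (quotK K₂ k (As b)) E₂))
      pathSetWeight-⊕ = begin
        pathSetWeight (G₁ ∪G G₂) KU (E₁ ⊕ E₂)
          ≈⟨ *-cong ι-pathSet-∪ (stateProb-∪ G₁ G₂ E₁ E₂) ⟩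
        sumFin² (λ a b → B a b * (y a * z b)) * (p₁ * p₂)
          ≈⟨ sym (trans (lin-cong Lm (λ a → lin-*ʳ Lm _ _)) (lin-*ʳ Lm _ _)) ⟩
        sumFin² (λ a b → (B a b * (y a * z b)) * (p₁ * p₂))
          ≈⟨ lin-cong Lm (λ a → lin-cong Lm (λ b → trans (*-assoc _ _ _) (*-congˡ (*-interchange _ _ _ _)))) ⟩
        sumFin² (λ a b → B a b * ((y a * p₁) * (z b * p₂))) ∎
        where
        y : Fin m → Carrier
        y a = ι (isPathSet (quotG G₁ k (As a)) (quotK K₁ k (As a)) E₁)
        z : Fin m → Carrier
        z b = ι (isPathSet (quotG G₂ k (As b)) (quotK K₂ k (As b)) E₂)
        p₁ p₂ : Carrier
        p₁ = stateProb G₁ E₁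
        p₂ = stateProb G₂ E₂

mainTheorem5 : ∀ {c ℓ} (R : CommutativeRing c ℓ) →
  let open CommutativeRing R
      open WithRing R
  in
  ∀ (nv : ℕ) (G₁ G₂ : SGraph nv) (V₁ V₂ K₁ K₂ : Fin nv → Bool)
    (n : ℕ) (k : Fin n → Fin nv) →
  Injective _≡_ _≡_ k →
  (∀ v → (V₁ v ∨ V₂ v) ≡ true) →
  (∀ e → (V₁ (proj₁ (ends G₁ e)) ∧ V₁ (proj₂ (ends G₁ e))) ≡ true) →
  (∀ e → (V₂ (proj₁ (ends G₂ e)) ∧ V₂ (proj₂ (ends G₂ e))) ≡ true) →
  (∀ v → K₁ v ≡ true → V₁ v ≡ true) →
  (∀ v → K₂ v ≡ true → V₂ v ≡ true) →
  (∀ v → ((K₁ v ∧ K₂ v) ≡ true) ⇔ (∃ λ a → k a ≡ v)) →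
  (∀ v → ((V₁ v ∧ V₂ v) ≡ true) ⇔ (∃ λ a → k a ≡ v)) →
  (∀ v → (K₁ v ∨ K₂ v) ≡ true →
    ∃ λ a → connectedB (stateAdj (G₁ ∪G G₂) (λ _ → true)) v (k a) ≡ true) →
  ∀ (m : ℕ) (As : Fin m → (Fin n → Fin n)) → IsEnumeration As →
  ∀ (B : Fin m → Fin m → Carrier) → IsInverseOf B (connMatrix As) →
  ∀ (l : ℕ) (i : ℕ) → i ≤ l →
    relCoeff (G₁ ∪G G₂) (λ v → K₁ v ∨ K₂ v) i
      ≈ sumFin (λ a → sumFin (λ b →
          B a b * convCoeff (relCoeff (quotG G₁ k (As a)) (quotK K₁ k (As a)))
                            (relCoeff (quotG G₂ k (As b)) (quotK K₂ k (As b))) i))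
-- With no interface node A is the zero matrix, so B exists only over the trivial ring.
mainTheorem5 R nv G₁ G₂ V₁ V₂ K₁ K₂ zero k _ _ _ _ _ _ _ _ _ m As enum B inv _ i _ =
  invertible-zero⇒trivial (connMatrix As) B inv (λ _ _ → refl) (proj₁ (proj₁ (enum λ ()))) _ _
  where
  open CommutativeRing R
  open WithRing R
  open Sums R
mainTheorem5 R nv G₁ G₂ V₁ V₂ K₁ K₂ (suc n) k k-inj _ ends∈V₁ ends∈V₂ K₁⊆V₁ K₂⊆V₂ K₁∩K₂ V₁∩V₂ _
             m As enum B inv _ i _ = begin
  relCoeff (G₁ ∪G G₂) KU i
    ≈⟨ relCoeff≈graded (G₁ ∪G G₂) KU i ⟩
  graded (ne G₁ +ℕ ne G₂) (pathSetWeight (G₁ ∪G G₂) KU) i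
    ≈⟨ graded-⊕ B (ne G₁) (ne G₂) w₁ w₂ _ pathSetWeight-⊕ i ⟩
  sumFin² (λ a b → B a b * convCoeff (graded (ne G₁) (w₁ a)) (graded (ne G₂) (w₂ b)) i)
    ≈⟨ lin-cong (sumFin-linear m) (λ a → lin-cong (sumFin-linear m) (λ b →
         *-congˡ (convCoeff-cong (graded≈relCoeff₁ a) (graded≈relCoeff₂ b) i))) ⟩
  sumFin (λ a → sumFin (λ b → B a b * convCoeff (relCoeff (quotG G₁ k (As a)) (quotK K₁ k (As a)))
                                                 (relCoeff (quotG G₂ k (As b)) (quotK K₂ k (As b))) i)) ∎
  where
  open CommutativeRing R hiding (zero)
  open WithRing R
  open Sums R
  open States R
  open Gluing R
  open Setting G₁ G₂ V₁ V₂ K₁ K₂ k k-inj ends∈V₁ ends∈V₂ K₁⊆V₁ K₂⊆V₂ K₁∩K₂ V₁∩V₂ As enum B (proj₂ inv) zero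
  open import Relation.Binary.Reasoning.Setoid setoid
  w₁ : Fin m → (Fin (ne G₁) → Bool) → Carrier
  w₁ a = pathSetWeight (quotG G₁ k (As a)) (quotK K₁ k (As a))
  w₂ : Fin m → (Fin (ne G₂) → Bool) → Carrier
  w₂ b = pathSetWeight (quotG G₂ k (As b)) (quotK K₂ k (As b))
  graded≈relCoeff₁ : ∀ a t → graded (ne G₁) (w₁ a) t ≈ relCoeff (quotG G₁ k (As a)) (quotK K₁ k (As a)) t
  graded≈relCoeff₁ a = sym ∘ relCoeff≈graded (quotG G₁ k (As a)) (quotK K₁ k (As a))
  graded≈relCoeff₂ : ∀ b t → graded (ne G₂) (w₂ b) t ≈ relCoeff (quotG G₂ k (As b)) (quotK K₂ k (As b)) t
  graded≈relCoeff₂ b = sym ∘ relCoeff≈graded (quotG G₂ k (As b)) (quotK K₂ k (As b))
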